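{- Let $G$ and $H$ be two nontrivial connected graphs. (1) If both $G$ and $H$ are complete, then $pvc(G\boxtimes H)=0$; if $diam(G)\geq3$ or $diam(H)\geq3$, then $pvc(G\boxtimes H)=2$; otherwise $pvc(G\boxtimes H)=1$. (2) Say a graph $X$ has property (P) if there exist two vertices of $X$ at distance $2$ that have exactly one common neighbor. If $diam(G)\leq 2$ and $diam(H)\leq2$, except in the case that $diam(G)=diam(H)=2$ and both $G$ and $H$ have property (P), then $pvc_2(G\boxtimes H)=1$; otherwise $pvc_2(G\boxtimes H)=2$. (3) If both $G$ and $H$ are complete, then $spvc(G\boxtimes H)=0$. If either ($diam(G)=2$ and $diam(H)\leq2$) or ($diam(G)\leq2$ and $diam(H)=2$), then $spvc(G\boxtimes H)=1$. If $diam(G)\leq2$ and $diam(H)\geq3$, then $spvc(G\boxtimes H)\leq spvc(H)$, and this bound is sharp (attained for some such $G$ and $H$). If $diam(G)\geq3$ and $diam(H)\geq3$, then $spvc(G\boxtimes H)\leq spvc(G)\cdot spvc(H)$.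
   Context: All graphs are simple, finite and undirected; nontrivial means having at least two vertices. The strong product $G\boxtimes H$ has vertex set $V(G)\times V(H)$, with $(g,h)$ adjacent to $(g',h')$ iff ($gg'\in E(G)$ and $h=h'$), or ($g=g'$ and $hh'\in E(H)$), or ($gg'\in E(G)$ and $hh'\in E(H)$). A set of paths between two vertices is called disjoint if they are internally vertex-disjoint. In a vertex-colored graph, a path is vertex-proper if any two adjacent internal vertices of the path receive different colors. A vertex-colored graph is proper vertex $k$-connected if any two vertices are joined by $k$ disjoint vertex-proper paths. For a $k$-connected graph $G$, $pvc_k(G)$ is the smallest number of colors in a vertex-coloring making $G$ proper vertex $k$-connected; $pvc(G)=pvc_1(G)$, with $pvc(G)=0$ for complete $G$ (for $k\ge2$, $pvc_k(G)\ge1$). A $u$-$v$ geodesic is a $u$-$v$ path of length $d(u,v)$. A vertex-colored graph is strong proper vertex-connected if for any two vertices $u,v$ there is a vertex-proper $u$-$v$ geodesic; $spvc(G)$ is the smallest number of colors needed for this, with $spvc(G)=0$ for complete $G$. -}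

module Defs where

open import Level using (0ℓ)
open import Data.Nat using (ℕ; zero; suc; _≤_; _<_; _*_)
open import Data.Fin using (Fin; remQuot)
open import Data.List using (List; []; _∷_; _++_; length)
open import Data.List.Relation.Unary.Linked using (Linked)
open import Data.List.Relation.Unary.Unique.Propositional using (Unique)
open import Data.List.Membership.Propositional using (_∈_; _∉_)
open import Data.Product using (Σ; ∃; ∃-syntax; _×_; _,_; proj₁; proj₂)
open import Data.Sum using (_⊎_; inj₁; inj₂)
open import Data.Empty using (⊥)
open import Relation.Nullary using (¬_)
open import Relation.Binary.PropositionalEquality using (_≡_; _≢_; refl; sym)

record Graph : Set₁ where
  field
    n      : ℕ
    Adj    : Fin n → Fin n → Set
    adjSym : ∀ {u v} → Adj u v → Adj v u
    adjIrr : ∀ {u} → ¬ Adj u u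

open Graph public

Vtx : Graph → Set
Vtx G = Fin (n G)

Nontrivial : Graph → Set
Nontrivial G = 2 ≤ n G

Complete : Graph → Set
Complete G = ∀ (u v : Vtx G) → u ≢ v → Adj G u v

-- Strong product.  The vertex set Fin (n G * n H) is identified with
-- Fin (n G) × Fin (n H) via the bijection remQuot (inverse: combine).

StrongAdj : (G H : Graph) → Fin (n G) × Fin (n H) → Fin (n G) × Fin (n H) → Set
StrongAdj G H (g , h) (g' , h') =
    (Adj G g g' × h ≡ h')
  ⊎ ((g ≡ g' × Adj H h h')
  ⊎ (Adj G g g' × Adj H h h'))

_⊠_ : Graph → Graph → Graph
G ⊠ H = record
  { n      = n G * n H
  ; Adj    = λ x y → StrongAdj G H (remQuot (n H) x) (remQuot (n H) y)
  ; adjSym = λ { (inj₁ (a , e)) → inj₁ (adjSym G a , sym e)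
               ; (inj₂ (inj₁ (e , b))) → inj₂ (inj₁ (sym e , adjSym H b))
               ; (inj₂ (inj₂ (a , b))) → inj₂ (inj₂ (adjSym G a , adjSym H b)) }
  ; adjIrr = λ { (inj₁ (a , _)) → adjIrr G a
               ; (inj₂ (inj₁ (_ , b))) → adjIrr H b
               ; (inj₂ (inj₂ (a , _))) → adjIrr G a }
  }

-- Paths.  A u-v path is given by its list of internal vertices; the full
-- vertex sequence u ∷ internal ++ [v] must consist of consecutively
-- adjacent, pairwise distinct vertices (so u ≢ v).

record Path (G : Graph) (u v : Vtx G) : Set where
  constructor mkPath
  field
    internal : List (Vtx G)
  verts : List (Vtx G)
  verts = u ∷ internal ++ v ∷ []
  field
    linked : Linked (Adj G) verts
    unique : Unique verts

open Path public

len : ∀ {G u v} → Path G u v → ℕ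
len p = suc (length (internal p))

Connected : Graph → Set
Connected G = ∀ (u v : Vtx G) → u ≢ v → Path G u v

Dist : (G : Graph) → Vtx G → Vtx G → ℕ → Set
Dist G u v d =
    (u ≡ v × d ≡ 0)
  ⊎ (Σ (Path G u v) λ p → len p ≡ d × (∀ (q : Path G u v) → d ≤ len q))

Diam : Graph → ℕ → Set
Diam G d =
    (∀ (u v : Vtx G) → ∃[ j ] (j ≤ d × Dist G u v j))
  × (∃[ u ] ∃[ v ] Dist G u v d)

DiamLe2 : Graph → Set
DiamLe2 G = ∃[ d ] (d ≤ 2 × Diam G d)

DiamGe3 : Graph → Set
DiamGe3 G = ∃[ d ] (3 ≤ d × Diam G d)

PropP : Graph → Set
PropP G = ∃[ u ] ∃[ v ] (Dist G u v 2 ×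
            ∃[ w ] ((Adj G u w × Adj G v w) ×
                    (∀ w' → Adj G u w' → Adj G v w' → w' ≡ w)))

Coloring : Graph → ℕ → Set
Coloring G m = Vtx G → Fin m

VertexProper : ∀ {G m u v} → Coloring G m → Path G u v → Set
VertexProper c p = Linked (λ x y → c x ≢ c y) (internal p)

DisjointFamily : ∀ {G u v} (k : ℕ) → (Fin k → Path G u v) → Set
DisjointFamily {G} k ps =
  ∀ (i j : Fin k) → i ≢ j →
    (internal (ps i) ≢ internal (ps j))
    × (∀ (x : Vtx G) → x ∈ internal (ps i) → x ∉ internal (ps j))

ProperVertexKConnected : ∀ {m} (G : Graph) (k : ℕ) → Coloring G m → Set
ProperVertexKConnected G k c =
  ∀ (u v : Vtx G) → u ≢ v →
    Σ (Fin k → Path G u v) λ ps → DisjointFamily k ps × (∀ i → VertexProper c (ps i))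

IsLeast : (ℕ → Set) → ℕ → Set
IsLeast P m = P m × (∀ m' → m' < m → ¬ P m')

Pvc : ℕ → Graph → ℕ → Set
Pvc k G m =
    ((k ≡ 1 × Complete G) × m ≡ 0)
  ⊎ (¬ (k ≡ 1 × Complete G)
     × IsLeast (λ m' → Σ (Coloring G m') (ProperVertexKConnected G k)) m)

Geodesic : ∀ {G u v} → Path G u v → Set
Geodesic {G} {u} {v} p = ∀ (q : Path G u v) → len p ≤ len q

StrongProperVertexConnected : ∀ {m} (G : Graph) → Coloring G m → Set
StrongProperVertexConnected G c =
  ∀ (u v : Vtx G) → u ≢ v →
    Σ (Path G u v) λ p → Geodesic p × VertexProper c p

Spvc : Graph → ℕ → Set
Spvc G m =
    (Complete G × m ≡ 0)
  ⊎ (¬ Complete G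
     × IsLeast (λ m' → Σ (Coloring G m') (StrongProperVertexConnected G)) m)

-- A vertex-proper path coloured with one colour has at most one internal
-- vertex.  Hence a pair at distance at least 3, which exists as soon as a
-- factor has diameter at least 3, rules out one colour, and so do unique
-- centres u-w-v in G and a-z-b in H for two disjoint paths from (u, a) to
-- (v, b), which would both have to pass through (w, z).  Two colours always
-- suffice: a connected graph has a 2-colouring (parity of the distance to a
-- root) joining any two vertices by a walk with alternating colours, and
-- colouring (g, h) by the sum of the colours of g and h yields two internally
-- disjoint alternating paths in G ⊠ H, one moving first in G and the other
-- first in H, or detouring through a neighbouring row or column.  When both
-- diameters are at most 2, paths of length at most 2 need no colouring, and
-- two disjoint ones exist unless both factors have property (P).
--
-- For spvc, d((g, h), (g', h')) is the larger of the two distances in the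
-- factors: follow a geodesic in the factor realising it while the other
-- coordinate follows its own geodesic and then waits.  Colouring (g, h) by
-- the pair of colours of g and h makes this geodesic vertex-proper, so
-- spvc(G ⊠ H) ≤ spvc(G) · spvc(H), and a single colour on G gives
-- spvc(G ⊠ H) ≤ spvc(H) when diam(G) ≤ 2.  K₂ ⊠ P₄ attains this bound.

module Submission where

open import Defs
open import Data.Empty using (⊥-elim)
open import Data.Fin using (Fin; combine; remQuot; toℕ) renaming (zero to fzero; suc to fsuc; _≟_ to _≟ᶠ_)
open import Data.Fin.Properties
  using (any?; all?; remQuot-combine; combine-remQuot; combine-injectiveˡ; combine-injectiveʳ)
open import Data.List using (List; []; _∷_; _++_; length; map; concat; replicate; zip; allFin; initLast; _∷ʳ′_)
open import Data.List.Properties using (++-assoc; length-++; length-map; length-replicate; map-++)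
open import Data.List.Membership.Propositional using (_∈_; _∉_)
open import Data.List.Membership.Propositional.Properties
  using (∈-++⁻; ∈-++⁺ˡ; ∈-++⁺ʳ; ∈-map⁺; ∈-map⁻; ∈-allFin; ∈-concat⁺′; ∈-concat⁻′)
open import Data.List.Membership.DecPropositional using () renaming (_∈?_ to ∈-dec)
open import Data.List.Relation.Unary.All as All using (All; []; _∷_)
open import Data.List.Relation.Unary.All.Properties using (¬Any⇒All¬; All¬⇒¬Any)
open import Data.List.Relation.Unary.AllPairs as AllPairs using ([]; _∷_)
open import Data.List.Relation.Unary.Any using (here; there)
open import Data.List.Relation.Unary.Linked as Linked using (Linked; []; [-]; _∷_)
import Data.List.Relation.Unary.Linked.Properties as Linked
open import Data.List.Relation.Unary.Unique.Propositional using (Unique)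
import Data.List.Relation.Unary.Unique.Propositional.Properties as Unique
import Data.List.Relation.Unary.Unique.DecPropositional as UniqueDec
open import Data.Nat using (ℕ; zero; suc; pred; _≤_; _<_; z≤n; s≤s; _+_; _*_; _∸_; _≤?_) renaming (_≟_ to _≟ℕ_)
open import Data.Nat.Induction using (<-rec)
open import Data.Nat.Properties
  using (≤-refl; ≤-trans; ≤-antisym; ≤-reflexive; ≤-pred; <⇒≤; ≰⇒>; ≮⇒≥; m≤n⇒m≤1+n; n≤1+n; 1+n≢n;
         +-comm; +-suc; +-identityʳ; suc-injective; +-monoˡ-≤; +-cancelʳ-≤; m+[n∸m]≡n; anyUpTo?; *-identityˡ;
         module ≤-Reasoning)
open import Data.Product using (Σ; ∃; ∃-syntax; _×_; _,_; proj₁; proj₂)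
open import Data.Product.Properties using (≡-dec)
open import Data.Sum using (_⊎_; inj₁; inj₂)
open import Data.Vec.Functional using (head; tail) renaming (_∷_ to _◂_)
open import Function using (_∘′_)
open import Relation.Binary.Definitions using (DecidableEquality)
open import Relation.Binary.PropositionalEquality using (_≡_; _≢_; refl; sym; trans; cong; cong₂; subst; subst₂)
open import Relation.Nullary using (¬_; Dec; yes; no)
open import Relation.Nullary.Decidable using (_×-dec_; _⊎-dec_; ¬?; True; toWitness)

private variable
  A B : Set

-- A walk from a is given by the list of the vertices after a.
lastOf : A → List A → A
lastOf a []       = a
lastOf a (x ∷ xs) = lastOf x xs

lastOf-++ : ∀ (a : A) xs ys → lastOf a (xs ++ ys) ≡ lastOf (lastOf a xs) ys
lastOf-++ a []       ys = refl
lastOf-++ a (x ∷ xs) ys = lastOf-++ x xs ys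

lastOf-∷ʳ : ∀ (a : A) xs b → lastOf a (xs ++ b ∷ []) ≡ b
lastOf-∷ʳ a xs b = lastOf-++ a xs (b ∷ [])

lastOf-map : ∀ (f : A → B) a xs → lastOf (f a) (map f xs) ≡ f (lastOf a xs)
lastOf-map f a []       = refl
lastOf-map f a (x ∷ xs) = lastOf-map f x xs

length-∷ʳ : ∀ (xs : List A) x → length (xs ++ x ∷ []) ≡ suc (length xs)
length-∷ʳ []       x = refl
length-∷ʳ (_ ∷ xs) x = cong suc (length-∷ʳ xs x)

linked-++ : ∀ {R : A → A → Set} a xs ys →
            Linked R (a ∷ xs) → Linked R (lastOf a xs ∷ ys) → Linked R (a ∷ xs ++ ys)
linked-++ a []       ys _        l₂ = l₂
linked-++ a (x ∷ xs) ys (r ∷ l₁) l₂ = r ∷ linked-++ x xs ys l₁ l₂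

reverseWalk : A → List A → List A
reverseWalk a []       = []
reverseWalk a (x ∷ xs) = reverseWalk x xs ++ a ∷ []

lastOf-reverseWalk : ∀ (a : A) xs → lastOf (lastOf a xs) (reverseWalk a xs) ≡ a
lastOf-reverseWalk a []       = refl
lastOf-reverseWalk a (x ∷ xs) = lastOf-∷ʳ _ (reverseWalk x xs) a

linked-reverseWalk : ∀ {R : A → A → Set} → (∀ {x y} → R x y → R y x) →
                     ∀ a xs → Linked R (a ∷ xs) → Linked R (lastOf a xs ∷ reverseWalk a xs)
linked-reverseWalk sym-R a []       _        = [-]
linked-reverseWalk sym-R a (x ∷ xs) (r ∷ lk) =
  linked-++ _ (reverseWalk x xs) (a ∷ [])
    (linked-reverseWalk sym-R x xs lk)
    (subst (λ z → Linked _ (z ∷ a ∷ [])) (sym (lastOf-reverseWalk x xs)) (sym-R r ∷ [-]))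

-- A chain is the relation-generic counterpart of a path: its internal
-- vertices, with the full vertex sequence R-linked and duplicate-free.
Chain : (A → A → Set) → A → A → Set
Chain R u v = Σ (List _) λ i → Linked R (u ∷ i ++ v ∷ []) × Unique (u ∷ i ++ v ∷ [])

edgeChain : ∀ {R : A → A → Set} {u v} → R u v → u ≢ v → Chain R u v
edgeChain r u≢v = [] , r ∷ [-] , (u≢v ∷ []) ∷ [] ∷ []

twoEdgeChain : ∀ {R : A → A → Set} {u m v} → R u m → R m v → u ≢ m → u ≢ v → m ≢ v → Chain R u v
twoEdgeChain r₁ r₂ u≢m u≢v m≢v = _ ∷ [] , r₁ ∷ r₂ ∷ [-] , (u≢m ∷ u≢v ∷ []) ∷ (m≢v ∷ []) ∷ [] ∷ []

uniqueWalk⇒chain : ∀ {R : A → A → Set} {u v} ys → Linked R (u ∷ ys) → Unique (u ∷ ys) →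
                   lastOf u ys ≡ v → u ≢ v → Σ (Chain R u v) λ p → ys ≡ proj₁ p ++ v ∷ []
uniqueWalk⇒chain ys lk un ends u≢v with initLast ys
... | []       = ⊥-elim (u≢v ends)
... | i ∷ʳ′ x with refl ← trans (sym (lastOf-∷ʳ _ i x)) ends = (i , lk , un) , refl

record UniqueWalk (R : A → A → Set) (a b : A) (n : ℕ) : Set where
  constructor uniqueWalk
  field
    steps   : List A
    linked  : Linked R (a ∷ steps)
    unique  : Unique (a ∷ steps)
    reaches : lastOf a steps ≡ b
    bounded : length steps ≤ n

UniqueWalk-mono : ∀ {R : A → A → Set} {a b b' n n'} → b ≡ b' → n ≤ n' →
                  UniqueWalk R a b n → UniqueWalk R a b' n'
UniqueWalk-mono refl n≤n' (uniqueWalk s lk un e le) = uniqueWalk s lk un e (≤-trans le n≤n')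

suffixFrom : ∀ {R : A → A → Set} {a} x xs → a ∈ x ∷ xs → Linked R (x ∷ xs) → Unique (x ∷ xs) →
             UniqueWalk R a (lastOf x xs) (length xs)
suffixFrom x xs       (here refl) lk       un       = uniqueWalk xs lk un refl ≤-refl
suffixFrom x (y ∷ xs) (there a∈)  (_ ∷ lk) (_ ∷ un) =
  UniqueWalk-mono refl (n≤1+n _) (suffixFrom y xs a∈ lk un)

eraseLoops : ∀ {R : A → A → Set} → DecidableEquality A →
             ∀ a xs → Linked R (a ∷ xs) → UniqueWalk R a (lastOf a xs) (length xs)
eraseLoops _≟_ a []       _        = uniqueWalk [] [-] ([] ∷ []) refl z≤n
eraseLoops _≟_ a (x ∷ xs) (r ∷ lk) with eraseLoops _≟_ x xs lk
... | uniqueWalk ys lk' un' ends le with ∈-dec _≟_ a (x ∷ ys)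
...   | yes a∈ = UniqueWalk-mono ends (m≤n⇒m≤1+n le) (suffixFrom x ys a∈ lk' un')
...   | no  a∉ = uniqueWalk (x ∷ ys) (r ∷ lk') (¬Any⇒All¬ _ a∉ ∷ un') ends (s≤s le)

walk⇒chain : ∀ {R : A → A → Set} → DecidableEquality A →
             ∀ {u v} ys → Linked R (u ∷ ys) → lastOf u ys ≡ v → u ≢ v →
             Σ (Chain R u v) λ p → length (proj₁ p) < length ys
walk⇒chain _≟_ {u} ys lk ends u≢v with eraseLoops _≟_ u ys lk
... | uniqueWalk zs lk' un' ends' le with uniqueWalk⇒chain zs lk' un' (trans ends' ends) u≢v
... | (i , c) , refl = (i , c) , ≤-trans (≤-reflexive (sym (length-∷ʳ i _))) le

chain-internal-≢ˡ : ∀ {R : A → A → Set} {u v z} (p : Chain R u v) → z ∈ proj₁ p → z ≢ u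
chain-internal-≢ˡ (_ , _ , u∉ ∷ _) z∈ z≡u = All.lookup u∉ (∈-++⁺ˡ z∈) (sym z≡u)

chain-internal-≢ʳ : ∀ {R : A → A → Set} {u v z} (p : Chain R u v) → z ∈ proj₁ p → z ≢ v
chain-internal-≢ʳ (i , _ , _ ∷ un) = lemma i un
  where
  lemma : ∀ {v z : A} i → Unique (i ++ v ∷ []) → z ∈ i → z ≢ v
  lemma (x ∷ i) (x∉ ∷ _)  (here refl) refl = All.lookup x∉ (∈-++⁺ʳ i (here refl)) refl
  lemma (x ∷ i) (_ ∷ un)  (there z∈)       = lemma i un z∈

∈-init : ∀ {z v : A} i → z ∈ i ++ v ∷ [] → z ≢ v → z ∈ i
∈-init i z∈ z≢v with ∈-++⁻ i z∈
... | inj₁ z∈i        = z∈i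
... | inj₂ (here z≡v) = ⊥-elim (z≢v z≡v)

chain-first : ∀ {R : A → A → Set} {u v} → Chain R u v → ∃ λ w → R u w
chain-first ([]    , r ∷ _ , _) = _ , r
chain-first (_ ∷ _ , r ∷ _ , _) = _ , r

chain-map : ∀ {R S : A → A → Set} → (∀ {a b} → R a b → S a b) → ∀ {u v} → Chain R u v → Chain S u v
chain-map f (i , lk , un) = i , Linked.map f lk , un

chain-internal-linked : ∀ {R : A → A → Set} {u v} (p : Chain R u v) → Linked R (proj₁ p)
chain-internal-linked (i , lk , _) = init-linked i (Linked.tail lk)
  where
  init-linked : ∀ {R : A → A → Set} {v} i → Linked R (i ++ v ∷ []) → Linked R i
  init-linked []          _        = []
  init-linked (x ∷ [])    _        = [-]
  init-linked (x ∷ y ∷ i) (r ∷ lk) = r ∷ init-linked (y ∷ i) lk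

DisjointChains : (A → A → Set) → A → A → Set
DisjointChains R u v = Σ (Chain R u v) λ p → Σ (Chain R u v) λ q →
                         (∃ λ z → z ∈ proj₁ p) × (∀ z → z ∈ proj₁ p → z ∉ proj₁ q)

AdjOrEq : (G : Graph) → Vtx G → Vtx G → Set
AdjOrEq G a b = a ≡ b ⊎ Adj G a b

adj⇒≢ : ∀ {G u v} → Adj G u v → u ≢ v
adj⇒≢ {G} a refl = adjIrr G a

adjOrEq-≢ : ∀ {G u v} → AdjOrEq G u v → u ≢ v → Adj G u v
adjOrEq-≢ (inj₁ u≡v) u≢v = ⊥-elim (u≢v u≡v)
adjOrEq-≢ (inj₂ a)   _   = a

complete⇒adjOrEq : ∀ {G} → Complete G → ∀ u v → AdjOrEq G u v
complete⇒adjOrEq complete u v with u ≟ᶠ v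
... | yes u≡v = inj₁ u≡v
... | no  u≢v = inj₂ (complete u v u≢v)

adjOrEq⇒complete : ∀ {G} → (∀ u v → AdjOrEq G u v) → Complete G
adjOrEq⇒complete adjOrEq u v u≢v with adjOrEq u v
... | inj₁ u≡v = ⊥-elim (u≢v u≡v)
... | inj₂ a   = a

path-≢ : ∀ {G u v} → Path G u v → u ≢ v
path-≢ {u = u} (mkPath i _ (u∉ ∷ _)) refl = All¬⇒¬Any u∉ (∈-++⁺ʳ i (here refl))

edgePath : ∀ {G u v} → Adj G u v → Path G u v
edgePath {G} a = mkPath [] (a ∷ [-]) ((adj⇒≢ {G} a ∷ []) ∷ [] ∷ [])

chain⇒path : ∀ {G u v} → Chain (Adj G) u v → Path G u v
chain⇒path (i , lk , un) = mkPath i lk un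

vertex₀ : ∀ {m} → 2 ≤ m → Fin m
vertex₀ (s≤s _) = fzero

another : ∀ {m} → 2 ≤ m → (x : Fin m) → ∃ λ y → x ≢ y
another (s≤s (s≤s _)) fzero    = fsuc fzero , λ ()
another (s≤s (s≤s _)) (fsuc _) = fzero , λ ()

neighbour : ∀ {G} → Nontrivial G → Connected G → ∀ x → ∃ λ y → Adj G x y
neighbour nt C x with another nt x
... | y , x≢y with C x y x≢y
... | mkPath []      (a ∷ _) _ = y , a
... | mkPath (w ∷ _) (a ∷ _) _ = w , a

dist-self : ∀ {G u d} → Dist G u u d → d ≡ 0
dist-self (inj₁ (_ , d≡0)) = d≡0
dist-self (inj₂ (p , _))   = ⊥-elim (path-≢ p refl)

dist-suc⇒≢ : ∀ {G u v d} → Dist G u v (suc d) → u ≢ v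
dist-suc⇒≢ D refl with () ← dist-self D

dist⇒geodesic : ∀ {G u v d} → Dist G u v d → u ≢ v → Σ (Path G u v) λ p → Geodesic p × len p ≡ d
dist⇒geodesic (inj₁ (u≡v , _))      u≢v = ⊥-elim (u≢v u≡v)
dist⇒geodesic (inj₂ (p , refl , min)) _ = p , min , refl

dist-≤-len : ∀ {G u v d} → Dist G u v d → (q : Path G u v) → d ≤ len q
dist-≤-len (inj₁ (refl , _))   q = ⊥-elim (path-≢ q refl)
dist-≤-len (inj₂ (_ , _ , min)) q = min q

dist-unique : ∀ {G u v d d'} → Dist G u v d → Dist G u v d' → d ≡ d'
dist-unique (inj₁ (refl , refl)) D' = sym (dist-self D')
dist-unique D@(inj₂ (p , refl , _)) D' with dist⇒geodesic D' (path-≢ p)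
... | p' , _ , refl = ≤-antisym (dist-≤-len D p') (dist-≤-len D' p)

dist2⇒¬AdjOrEq : ∀ {G u v} → Dist G u v 2 → ¬ AdjOrEq G u v
dist2⇒¬AdjOrEq D (inj₁ refl) with () ← dist-self D
dist2⇒¬AdjOrEq D (inj₂ a) with dist-≤-len D (edgePath a)
... | s≤s ()

dist≤2-cases : ∀ {G u v j} → Dist G u v j → j ≤ 2 →
               AdjOrEq G u v ⊎ (Dist G u v 2 × ∃[ w ] (Adj G u w × Adj G w v))
dist≤2-cases (inj₁ (u≡v , _))                             _ = inj₁ (inj₁ u≡v)
dist≤2-cases (inj₂ (mkPath [] (a ∷ _) _ , _))             _ = inj₁ (inj₂ a)
dist≤2-cases D@(inj₂ (mkPath (w ∷ []) (a ∷ b ∷ _) _ , refl , _)) _ = inj₂ (D , w , a , b)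
dist≤2-cases (inj₂ (mkPath (_ ∷ _ ∷ _) _ _ , refl , _)) (s≤s (s≤s ()))

unique-centre : ∀ {G u v w m} → Dist G u v 2 → (∀ w' → Adj G u w' → Adj G v w' → w' ≡ w) →
                AdjOrEq G u m → AdjOrEq G m v → m ≡ w
unique-centre D only-w (inj₁ refl) m≈v        = ⊥-elim (dist2⇒¬AdjOrEq D m≈v)
unique-centre D only-w (inj₂ u~m)  (inj₁ refl) = ⊥-elim (dist2⇒¬AdjOrEq D (inj₂ u~m))
unique-centre {G} D only-w (inj₂ u~m) (inj₂ m~v) = only-w _ u~m (adjSym G m~v)

another-centre-or-PropP : ∀ {G u v w} → (∀ a b → Dec (Adj G a b)) → Dist G u v 2 → Adj G u w → Adj G w v →
                          (∃ λ w₂ → w₂ ≢ w × Adj G u w₂ × Adj G w₂ v) ⊎ PropP G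
another-centre-or-PropP {G} {u} {v} {w} adj? D u~w w~v
  with any? (λ w₂ → ¬? (w₂ ≟ᶠ w) ×-dec (adj? u w₂ ×-dec adj? w₂ v))
... | yes (w₂ , w₂≢w , u~w₂ , w₂~v) = inj₁ (w₂ , w₂≢w , u~w₂ , w₂~v)
... | no  none = inj₂ (u , v , D , w , (u~w , adjSym G w~v) , only-w)
  where
  only-w : ∀ w' → Adj G u w' → Adj G v w' → w' ≡ w
  only-w w' u~w' v~w' with w' ≟ᶠ w
  ... | yes w'≡w = w'≡w
  ... | no  w'≢w = ⊥-elim (none (w' , w'≢w , u~w' , adjSym G v~w'))

-- With all distances known, adjacency is distance 1, hence decidable.
adj?-from-dist : ∀ {G} → (∀ u v → ∃[ d ] Dist G u v d) → ∀ u v → Dec (Adj G u v)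
adj?-from-dist {G} D u v with D u v
... | _ , inj₁ (refl , _)                            = no (adjIrr G)
... | _ , inj₂ (mkPath [] (a ∷ _) _ , _)             = yes a
... | _ , inj₂ (mkPath (_ ∷ _) _ _ , refl , min) = no λ a → 2≰1 (min (edgePath a))
  where
  2≰1 : ∀ {k} → ¬ suc (suc k) ≤ 1
  2≰1 (s≤s ())

adj?-from-diam : ∀ {G d} → Diam G d → ∀ u v → Dec (Adj G u v)
adj?-from-diam (all , _) = adj?-from-dist λ u v → proj₁ (all u v) , proj₂ (proj₂ (all u v))

diam≤2-dist : ∀ {G} → DiamLe2 G → ∀ u v → ∃[ j ] (j ≤ 2 × Dist G u v j)
diam≤2-dist (d , d≤2 , all , _) u v with all u v
... | j , j≤d , D = j , ≤-trans j≤d d≤2 , D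

diam≤2-dist2⇒diam2 : ∀ {G u v} → DiamLe2 G → Dist G u v 2 → Diam G 2
diam≤2-dist2⇒diam2 (d , d≤2 , all , far) D with all _ _
... | j , j≤d , D' = subst (Diam _) (≤-antisym d≤2 (subst (_≤ d) (dist-unique D' D) j≤d)) (all , far)

diam≥3⇒¬complete : ∀ {G} → DiamGe3 G → ¬ Complete G
diam≥3⇒¬complete (zero , () , _)
diam≥3⇒¬complete (suc d , 3≤d , _ , u , v , D) complete
  with ≤-trans 3≤d (dist-≤-len D (edgePath (complete u v (dist-suc⇒≢ D))))
... | s≤s ()

FarPair : Graph → Set
FarPair K = Σ (Vtx K) λ x → Σ (Vtx K) λ y → x ≢ y × (∀ (q : Path K x y) → 3 ≤ len q)

farPair⇒¬complete : ∀ {K} → FarPair K → ¬ Complete K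
farPair⇒¬complete (x , y , x≢y , far) complete with far (edgePath (complete x y x≢y))
... | s≤s ()

monochrome : ∀ {G} → Coloring G 1
monochrome _ = fzero

no-colouring₀ : ∀ {G} → Vtx G → ¬ Coloring G 0
no-colouring₀ x c with c x
... | ()

short-path-proper : ∀ {G m u v} (c : Coloring G m) (p : Path G u v) → len p ≤ 2 → VertexProper c p
short-path-proper c (mkPath []          _ _) _ = []
short-path-proper c (mkPath (_ ∷ [])    _ _) _ = [-]
short-path-proper c (mkPath (_ ∷ _ ∷ _) _ _) (s≤s (s≤s ()))

one-colour-proper⇒short : ∀ {G u v} (c : Coloring G 1) (p : Path G u v) → VertexProper c p → len p ≤ 2
one-colour-proper⇒short c (mkPath []          _ _) _ = s≤s z≤n
one-colour-proper⇒short c (mkPath (_ ∷ [])    _ _) _ = s≤s (s≤s z≤n)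
one-colour-proper⇒short c (mkPath (x ∷ y ∷ _) _ _) (c≢ ∷ _) with c x | c y
... | fzero | fzero = ⊥-elim (c≢ refl)

IsLeast-1 : ∀ {P : ℕ → Set} → ¬ P 0 → P 1 → IsLeast P 1
IsLeast-1 ¬P0 P1 = P1 , λ { zero _ → ¬P0 ; (suc _) (s≤s ()) }

IsLeast-2 : ∀ {P : ℕ → Set} → ¬ P 0 → ¬ P 1 → P 2 → IsLeast P 2
IsLeast-2 ¬P0 ¬P1 P2 = P2 , λ { zero _ → ¬P0 ; (suc zero) _ → ¬P1 ; (suc (suc _)) (s≤s (s≤s ())) }

pathPair : ∀ {K x y} → Path K x y → Path K x y → Fin 2 → Path K x y
pathPair p q fzero    = p
pathPair p q (fsuc _) = q

disjointFamily-pair : ∀ {K x y} (p q : Path K x y) → ∃ (_∈ internal p) →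
                      (∀ z → z ∈ internal p → z ∉ internal q) → DisjointFamily {K} 2 (pathPair p q)
disjointFamily-pair p q (z , z∈p) disjoint = family
  where
  p≢q : internal p ≢ internal q
  p≢q e = disjoint z z∈p (subst (z ∈_) e z∈p)
  family : DisjointFamily 2 (pathPair p q)
  family fzero        fzero        i≢j = ⊥-elim (i≢j refl)
  family fzero        (fsuc fzero) _   = p≢q , disjoint
  family (fsuc fzero) fzero        _   = (λ e → p≢q (sym e)) , λ z z∈q z∈p → disjoint z z∈p z∈q
  family (fsuc fzero) (fsuc fzero) i≢j = ⊥-elim (i≢j refl)

singletonFamily : ∀ {K x y} (p : Path K x y) → DisjointFamily {K} 1 (λ _ → p)
singletonFamily p fzero fzero i≢j = ⊥-elim (i≢j refl)

strong⇒proper-1-connected : ∀ {G m} {c : Coloring G m} → StrongProperVertexConnected G c → ProperVertexKConnected G 1 c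
strong⇒proper-1-connected spc u v u≢v with spc u v u≢v
... | p , _ , proper = (λ _ → p) , singletonFamily p , λ _ → proper

proper-2⇒proper-1-connected : ∀ {G m} {c : Coloring G m} → ProperVertexKConnected G 2 c → ProperVertexKConnected G 1 c
proper-2⇒proper-1-connected pc u v u≢v with pc u v u≢v
... | ps , _ , proper = (λ _ → ps fzero) , singletonFamily (ps fzero) , λ _ → proper fzero

proper-connected⇒connected : ∀ {G m k} {c : Coloring G m} → ProperVertexKConnected G (suc k) c → Connected G
proper-connected⇒connected pc u v u≢v = proj₁ (pc u v u≢v) fzero

farPair⇒¬proper-colouring₁ : ∀ {K k} → FarPair K → ¬ Σ (Coloring K 1) (ProperVertexKConnected K (suc k))
farPair⇒¬proper-colouring₁ (x , y , x≢y , far) (c , pc) with pc x y x≢y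
... | ps , _ , proper with ≤-trans (far (ps fzero)) (one-colour-proper⇒short c (ps fzero) (proper fzero))
... | s≤s (s≤s ())

farPair⇒¬strong-colouring₁ : ∀ {K} → FarPair K → ¬ Σ (Coloring K 1) (StrongProperVertexConnected K)
farPair⇒¬strong-colouring₁ far (c , spc) = farPair⇒¬proper-colouring₁ {k = 0} far (c , strong⇒proper-1-connected spc)

diam≤2⇒strong-monochrome : ∀ {G} → DiamLe2 G → StrongProperVertexConnected G (monochrome {G})
diam≤2⇒strong-monochrome diam u v u≢v with diam≤2-dist diam u v
... | j , j≤2 , D with dist⇒geodesic D u≢v
... | p , geo , refl = p , geo , short-path-proper _ p j≤2

farPair⇒2≤spvc : ∀ {K a} → FarPair K → Spvc K a → 2 ≤ a
farPair⇒2≤spvc far (inj₁ (complete , _)) = ⊥-elim (farPair⇒¬complete far complete)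
farPair⇒2≤spvc {K} {zero}  (x , _) (inj₂ (_ , (c , _) , _)) = ⊥-elim (no-colouring₀ {K} x c)
farPair⇒2≤spvc {a = suc zero}      far     (inj₂ (_ , spc , _))     = ⊥-elim (farPair⇒¬strong-colouring₁ far spc)
farPair⇒2≤spvc {a = suc (suc _)}   _       _                        = s≤s (s≤s z≤n)


-- Finite search

least-such : ∀ {P : ℕ → Set} → (∀ m → Dec (P m)) → ∀ N → P N → ∃ (IsLeast P)
least-such {P} P? = <-rec (λ N → P N → ∃ (IsLeast P)) step
  where
  step : ∀ N → (∀ {m} → m < N → P m → ∃ (IsLeast P)) → P N → ∃ (IsLeast P)
  step N rec pN with anyUpTo? P? N
  ... | yes (m , m<N , pm) = rec m<N pm
  ... | no  none           = N , pN , λ m m<N pm → none (m , m<N , pm)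

any-list? : ∀ {n} k {P : List (Fin n) → Set} → (∀ l → Dec (P l)) → Dec (∃ λ l → length l ≡ k × P l)
any-list? zero P? with P? []
... | yes p = yes ([] , refl , p)
... | no ¬p = no λ { ([] , _ , p) → ¬p p ; (_ ∷ _ , () , _) }
any-list? (suc k) P? with any? (λ x → any-list? k (λ l → P? (x ∷ l)))
... | yes (x , l , refl , p) = yes (x ∷ l , refl , p)
... | no  none               = no λ { ([] , () , _) ; (x ∷ l , refl , p) → none (x , l , refl , p) }

◂-cong : ∀ {N} {A : Set} {a : A} {c c' : Fin N → A} → (∀ x → c x ≡ c' x) → ∀ x → (a ◂ c) x ≡ (a ◂ c') x
◂-cong eq fzero    = refl
◂-cong eq (fsuc x) = eq x

head-◂-tail : ∀ {N} {A : Set} (c : Fin (suc N) → A) x → c x ≡ (head c ◂ tail c) x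
head-◂-tail c fzero    = refl
head-◂-tail c (fsuc x) = refl

any-function? : ∀ N m {P : (Fin N → Fin m) → Set} → (∀ c → Dec (P c)) →
                (∀ {c c'} → (∀ x → c x ≡ c' x) → P c → P c') → Dec (Σ _ P)
any-function? zero m P? resp with P? (λ ())
... | yes p = yes (_ , p)
... | no ¬p = no λ (c , p) → ¬p (resp (λ ()) p)
any-function? (suc N) m P? resp
  with any? (λ a → any-function? N m (λ c → P? (a ◂ c)) (λ eq → resp (◂-cong eq)))
... | yes (a , c , p) = yes (_ , p)
... | no  none        = no λ (c , p) → none (head c , tail c , resp (head-◂-tail c) p)

module _ {G : Graph} (adj? : ∀ u v → Dec (Adj G u v)) where

  PathOfLength : Vtx G → Vtx G → ℕ → Set
  PathOfLength u v k = ∃ λ i → length i ≡ k × Linked (Adj G) (u ∷ i ++ v ∷ []) × Unique (u ∷ i ++ v ∷ [])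

  pathOfLength? : ∀ u v k → Dec (PathOfLength u v k)
  pathOfLength? u v k =
    any-list? k λ i → Linked.linked? adj? (u ∷ i ++ v ∷ []) ×-dec UniqueDec.unique? _≟ᶠ_ (u ∷ i ++ v ∷ [])

  dist-from-path : ∀ {u v} → Path G u v → ∃[ d ] Dist G u v d
  dist-from-path {u} {v} p
    with least-such (pathOfLength? u v) (length (internal p)) (internal p , refl , linked p , unique p)
  ... | k , (i , refl , lk , un) , least =
    suc k , inj₂ (mkPath i lk un , refl , λ q → s≤s (≮⇒≥ λ lt → least _ lt (internal q , refl , linked q , unique q)))

  dist-total : Connected G → ∀ u v → ∃[ d ] Dist G u v d
  dist-total C u v with u ≟ᶠ v
  ... | yes refl = 0 , inj₁ (refl , refl)
  ... | no  u≢v  = dist-from-path (C u v u≢v)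

-- A 2-colouring joining any two vertices by a properly coloured chain

flip₂ : Fin 2 → Fin 2
flip₂ fzero    = fsuc fzero
flip₂ (fsuc _) = fzero

parity : ℕ → Fin 2
parity zero    = fzero
parity (suc k) = flip₂ (parity k)

parity-suc : ∀ k → parity (suc k) ≢ parity k
parity-suc k with parity k
... | fzero      = λ ()
... | fsuc fzero = λ ()

ColourStep : ∀ {m} (G : Graph) → (Vtx G → Fin m) → Vtx G → Vtx G → Set
ColourStep G c x y = Adj G x y × c x ≢ c y

-- Unlike VertexProper, this also asks the endpoints to differ in colour from their neighbours.
ProperlyConnected : ∀ {m} (G : Graph) → (Vtx G → Fin m) → Set
ProperlyConnected G c = ∀ u v → u ≢ v → Chain (ColourStep G c) u v

module ParityColouring (G : Graph) (r : Vtx G) (d : Vtx G → ℕ) (D : ∀ x → Dist G r x (d x)) where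

  d-root : d r ≡ 0
  d-root = dist-self (D r)

  geodesicWalk : ∀ a → Σ (List (Vtx G)) λ zs → Linked (Adj G) (r ∷ zs) × lastOf r zs ≡ a × length zs ≡ d a
  geodesicWalk a with a ≟ᶠ r
  ... | yes refl = [] , [-] , refl , sym d-root
  ... | no  a≢r with dist⇒geodesic (D a) (λ e → a≢r (sym e))
  ...   | mkPath i lk _ , _ , len≡ = i ++ a ∷ [] , lk , lastOf-∷ʳ r i a , trans (length-∷ʳ i a) len≡

  d-walk-≤ : ∀ a ys → Linked (Adj G) (a ∷ ys) → d (lastOf a ys) ≤ d a + length ys
  d-walk-≤ a ys lk with geodesicWalk a | lastOf a ys ≟ᶠ r
  ... | _ | yes e = subst (_≤ d a + length ys) (sym (trans (cong d e) d-root)) z≤n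
  ... | zs , lz , ez , len-zs | no e≢r
    with walk⇒chain _≟ᶠ_ (zs ++ ys)
           (linked-++ r zs ys lz (subst (λ z → Linked _ (z ∷ ys)) (sym ez) lk))
           (trans (lastOf-++ r zs ys) (cong (λ z → lastOf z ys) ez)) (λ e → e≢r (sym e))
  ... | c , shorter = begin
    d (lastOf a ys)        ≤⟨ dist-≤-len (D _) (chain⇒path c) ⟩
    suc (length (proj₁ c)) ≤⟨ shorter ⟩
    length (zs ++ ys)      ≡⟨ length-++ zs ⟩
    length zs + length ys  ≡⟨ cong (_+ length ys) len-zs ⟩
    d a + length ys        ∎
    where open ≤-Reasoning

  Ascending : Vtx G → Vtx G → Set
  Ascending x y = Adj G x y × d y ≡ suc (d x)

  geodesic-ascending : ∀ a l → Linked (Adj G) (a ∷ l) → d (lastOf a l) ≡ d a + length l →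
                       Linked Ascending (a ∷ l)
  geodesic-ascending a []      _        _    = [-]
  geodesic-ascending a (b ∷ l) (ab ∷ lk) ends = (ab , db) ∷ geodesic-ascending b l lk ends'
    where
    da<db : suc (d a) ≤ d b
    da<db = +-cancelʳ-≤ (length l) (suc (d a)) (d b)
              (subst (_≤ d b + length l) (trans ends (+-suc (d a) (length l))) (d-walk-≤ b l lk))
    db : d b ≡ suc (d a)
    db = ≤-antisym (subst (d b ≤_) (+-comm (d a) 1) (d-walk-≤ a (b ∷ []) (ab ∷ [-]))) da<db
    ends' : d (lastOf b l) ≡ d b + length l
    ends' = trans ends (trans (+-suc (d a) (length l)) (cong (_+ length l) (sym db)))

  colour : Vtx G → Fin 2
  colour x = parity (d x)

  ascending⇒colourStep : ∀ {x y} → Ascending x y → ColourStep G colour x y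
  ascending⇒colourStep {x} (a , e) = a , λ c → parity-suc (d x) (trans (sym (cong parity e)) (sym c))

  colourStep-sym : ∀ {x y} → ColourStep G colour x y → ColourStep G colour y x
  colourStep-sym (a , c≢) = adjSym G a , λ e → c≢ (sym e)

  rootWalk : ∀ a → Σ (List (Vtx G)) λ zs → Linked (ColourStep G colour) (r ∷ zs) × lastOf r zs ≡ a
  rootWalk a with geodesicWalk a
  ... | zs , lz , ez , len-zs =
    zs , Linked.map ascending⇒colourStep
           (geodesic-ascending r zs lz (trans (cong d ez) (trans (sym len-zs) (cong (_+ length zs) (sym d-root))))) ,
    ez

  properlyConnected : ProperlyConnected G colour
  properlyConnected u v u≢v with rootWalk u | rootWalk v
  ... | zu , lu , eu | zv , lv , ev = proj₁ (walk⇒chain _≟ᶠ_ (reverseWalk r zu ++ zv) walk ends u≢v)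
    where
    back : Linked (ColourStep G colour) (lastOf r zu ∷ reverseWalk r zu)
    back = linked-reverseWalk colourStep-sym r zu lu
    walk : Linked (ColourStep G colour) (u ∷ reverseWalk r zu ++ zv)
    walk = subst (λ z → Linked _ (z ∷ reverseWalk r zu ++ zv)) eu
             (linked-++ _ (reverseWalk r zu) zv back
               (subst (λ z → Linked _ (z ∷ zv)) (sym (lastOf-reverseWalk r zu)) lv))
    ends : lastOf u (reverseWalk r zu ++ zv) ≡ v
    ends = trans (lastOf-++ u (reverseWalk r zu) zv)
             (trans (cong (λ z → lastOf z zv)
                      (trans (cong (λ z → lastOf z (reverseWalk r zu)) (sym eu)) (lastOf-reverseWalk r zu)))
                    ev)

consecutivePairs : ∀ {A : Set} → List A → List (A × A)
consecutivePairs (x ∷ y ∷ l) = (x , y) ∷ consecutivePairs (y ∷ l)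
consecutivePairs _           = []

linked-consecutivePairs : ∀ {A : Set} (l : List A) → Linked (λ a b → (a , b) ∈ consecutivePairs l) l
linked-consecutivePairs []          = []
linked-consecutivePairs (x ∷ [])    = [-]
linked-consecutivePairs (x ∷ y ∷ l) = here refl ∷ Linked.map there (linked-consecutivePairs (y ∷ l))

consecutivePairs-linked : ∀ {A : Set} {R : A → A → Set} {a b} l → Linked R l → (a , b) ∈ consecutivePairs l → R a b
consecutivePairs-linked (x ∷ y ∷ l) (r ∷ _)  (here refl) = r
consecutivePairs-linked (x ∷ y ∷ l) (_ ∷ lk) (there ab)  = consecutivePairs-linked (y ∷ l) lk ab

-- Adjacency of a graph need not be decidable, so the distances behind the
-- parity colouring are taken in the union of the chosen paths from the root,
-- whose finitely many edges can be listed.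
module PathUnion (G : Graph) (C : Connected G) (r : Vtx G) where

  rootSteps : Vtx G → List (Vtx G)
  rootSteps x with r ≟ᶠ x
  ... | yes _   = []
  ... | no  r≢x = internal (C r x r≢x) ++ x ∷ []

  rootSteps-linked : ∀ x → Linked (Adj G) (r ∷ rootSteps x)
  rootSteps-linked x with r ≟ᶠ x
  ... | yes _   = [-]
  ... | no  r≢x = linked (C r x r≢x)

  rootSteps-ends : ∀ x → lastOf r (rootSteps x) ≡ x
  rootSteps-ends x with r ≟ᶠ x
  ... | yes r≡x = r≡x
  ... | no  r≢x = lastOf-∷ʳ r (internal (C r x r≢x)) x

  rootEdges : Vtx G → List (Vtx G × Vtx G)
  rootEdges x = consecutivePairs (r ∷ rootSteps x)

  edges : List (Vtx G × Vtx G)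
  edges = concat (map rootEdges (allFin (n G)))

  edge⇒adj : ∀ {a b} → (a , b) ∈ edges → Adj G a b
  edge⇒adj ab with ∈-concat⁻′ (map rootEdges (allFin (n G))) ab
  ... | _ , ab' , xs∈ with ∈-map⁻ rootEdges xs∈
  ...   | x , _ , refl = consecutivePairs-linked _ (rootSteps-linked x) ab'

  UnionAdj : Vtx G → Vtx G → Set
  UnionAdj a b = (a , b) ∈ edges ⊎ (b , a) ∈ edges

  unionAdj⇒adj : ∀ {a b} → UnionAdj a b → Adj G a b
  unionAdj⇒adj (inj₁ ab) = edge⇒adj ab
  unionAdj⇒adj (inj₂ ba) = adjSym G (edge⇒adj ba)

  Union : Graph
  Union = record
    { n      = n G
    ; Adj    = UnionAdj
    ; adjSym = λ { (inj₁ ab) → inj₂ ab ; (inj₂ ba) → inj₁ ba }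
    ; adjIrr = λ a → adjIrr G (unionAdj⇒adj a)
    }

  unionAdj? : ∀ a b → Dec (UnionAdj a b)
  unionAdj? a b = ∈-dec (≡-dec _≟ᶠ_ _≟ᶠ_) (a , b) edges ⊎-dec ∈-dec (≡-dec _≟ᶠ_ _≟ᶠ_) (b , a) edges

  rootSteps-union : ∀ x → Linked UnionAdj (r ∷ rootSteps x)
  rootSteps-union x =
    Linked.map (λ ab → inj₁ (∈-concat⁺′ ab (∈-map⁺ rootEdges (∈-allFin x)))) (linked-consecutivePairs (r ∷ rootSteps x))

  dist-union : ∀ x → ∃[ d ] Dist Union r x d
  dist-union x with r ≟ᶠ x
  ... | yes refl = 0 , inj₁ (refl , refl)
  ... | no  r≢x  = dist-from-path unionAdj?
                     (chain⇒path (proj₁ (walk⇒chain _≟ᶠ_ (rootSteps x) (rootSteps-union x) (rootSteps-ends x) r≢x)))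

  open ParityColouring Union r (λ x → proj₁ (dist-union x)) (λ x → proj₂ (dist-union x))

  two-colouring : Σ (Vtx G → Fin 2) (ProperlyConnected G)
  two-colouring =
    colour , λ u v u≢v → chain-map (λ (a , c≢) → unionAdj⇒adj a , c≢) (properlyConnected u v u≢v)

adjOrEq-chain⇒path : ∀ {L u v} → Chain (AdjOrEq L) u v → Path L u v
adjOrEq-chain⇒path {L} (i , lk , un) = mkPath i (strict lk un) un
  where
  strict : ∀ {l} → Linked (AdjOrEq L) l → Unique l → Linked (Adj L) l
  strict []                _                = []
  strict [-]               _                = [-]
  strict (inj₁ e ∷ _)      ((a≢b ∷ _) ∷ _) = ⊥-elim (a≢b e)
  strict (inj₂ a ∷ lk)     (_ ∷ un)         = a ∷ strict lk un

path-image : ∀ {K L : Graph} (f : Vtx K → Vtx L) → (∀ {a b} → Adj K a b → AdjOrEq L (f a) (f b)) →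
             ∀ {x y} (q : Path K x y) → f x ≢ f y → Σ (Path L (f x) (f y)) λ p → len p ≤ len q
path-image {K} {L} f f-adj {x} {y} (mkPath i lk _) fx≢fy
  with walk⇒chain {R = AdjOrEq L} (_≟ᶠ_ {n L}) (map f (i ++ y ∷ [])) (Linked.map⁺ (Linked.map f-adj lk))
         (trans (lastOf-map f x (i ++ y ∷ [])) (cong f (lastOf-∷ʳ x i y))) fx≢fy
... | c , shorter =
  adjOrEq-chain⇒path c , ≤-trans shorter (≤-reflexive (trans (length-map f (i ++ y ∷ [])) (length-∷ʳ i y)))

dist-image-≤ : ∀ {K L : Graph} (f : Vtx K → Vtx L) → (∀ {a b} → Adj K a b → AdjOrEq L (f a) (f b)) →
               ∀ {x y d} → Dist L (f x) (f y) d → (q : Path K x y) → d ≤ len q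
dist-image-≤ {L = L} f f-adj {x} {y} D q with f x ≟ᶠ f y
... | yes e = subst (_≤ len q) (sym (dist-self (subst (λ z → Dist L z (f y) _) e D))) z≤n
... | no fx≢fy with path-image f f-adj q fx≢fy
...   | p , shorter = ≤-trans (dist-≤-len D p) shorter

geodesic-image-≤ : ∀ {K L : Graph} (f : Vtx K → Vtx L) → (∀ {a b} → Adj K a b → AdjOrEq L (f a) (f b)) →
                   ∀ {x y} (p : Path L (f x) (f y)) → Geodesic p → (q : Path K x y) → len p ≤ len q
geodesic-image-≤ f f-adj p geo q with path-image f f-adj q (path-≢ p)
... | p' , shorter = ≤-trans (geo p') shorter

module StrongProduct (G H : Graph) where

  Pair : Set
  Pair = Vtx G × Vtx H

  _∼_ : Pair → Pair → Set
  _∼_ = StrongAdj G H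

  _≟ₚ_ : DecidableEquality Pair
  _≟ₚ_ = ≡-dec _≟ᶠ_ _≟ᶠ_

  ∼-intro : ∀ {g g' h h'} → AdjOrEq G g g' → AdjOrEq H h h' → (g , h) ≢ (g' , h') → (g , h) ∼ (g' , h')
  ∼-intro (inj₁ refl) (inj₁ refl) ne = ⊥-elim (ne refl)
  ∼-intro (inj₁ refl) (inj₂ b)    _  = inj₂ (inj₁ (refl , b))
  ∼-intro (inj₂ a)    (inj₁ refl) _  = inj₁ (a , refl)
  ∼-intro (inj₂ a)    (inj₂ b)    _  = inj₂ (inj₂ (a , b))

  ∼-introᴳ : ∀ {g g' h h'} → Adj G g g' → AdjOrEq H h h' → (g , h) ∼ (g' , h')
  ∼-introᴳ a b = ∼-intro (inj₂ a) b λ e → adj⇒≢ {G} a (cong proj₁ e)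

  ∼-introᴴ : ∀ {g g' h h'} → AdjOrEq G g g' → Adj H h h' → (g , h) ∼ (g' , h')
  ∼-introᴴ a b = ∼-intro a (inj₂ b) λ e → adj⇒≢ {H} b (cong proj₂ e)

  ∼-proj : ∀ {g g' h h'} → (g , h) ∼ (g' , h') → AdjOrEq G g g' × AdjOrEq H h h'
  ∼-proj (inj₁ (a , e))        = inj₂ a , inj₁ e
  ∼-proj (inj₂ (inj₁ (e , b))) = inj₁ e , inj₂ b
  ∼-proj (inj₂ (inj₂ (a , b))) = inj₂ a , inj₂ b

  ∼-≢ : ∀ {x y} → x ∼ y → x ≢ y
  ∼-≢ (inj₁ (a , _))        refl = adjIrr G a
  ∼-≢ (inj₂ (inj₁ (_ , b))) refl = adjIrr H b
  ∼-≢ (inj₂ (inj₂ (a , _))) refl = adjIrr G a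

  ∼? : (∀ a b → Dec (Adj G a b)) → (∀ a b → Dec (Adj H a b)) → ∀ p q → Dec (p ∼ q)
  ∼? adjG? adjH? (g , h) (g' , h') with (g ≟ᶠ g') ⊎-dec adjG? g g' | (h ≟ᶠ h') ⊎-dec adjH? h h' | (g , h) ≟ₚ (g' , h')
  ... | _      | _      | yes p≡q = no λ r → ∼-≢ r p≡q
  ... | yes g≈ | yes h≈ | no  p≢q = yes (∼-intro g≈ h≈ p≢q)
  ... | no ¬g≈ | _      | no  _   = no λ r → ¬g≈ (proj₁ (∼-proj r))
  ... | yes _  | no ¬h≈ | no  _   = no λ r → ¬h≈ (proj₂ (∼-proj r))

  vertex : Pair → Vtx (G ⊠ H)
  vertex (g , h) = combine g h

  coords : Vtx (G ⊠ H) → Pair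
  coords = remQuot (n H)

  coords-vertex : ∀ p → coords (vertex p) ≡ p
  coords-vertex (g , h) = remQuot-combine g h

  vertex-coords : ∀ x → vertex (coords x) ≡ x
  vertex-coords = combine-remQuot {n G} (n H)

  vertex-injective : ∀ {p q} → vertex p ≡ vertex q → p ≡ q
  vertex-injective {p} {q} e = trans (sym (coords-vertex p)) (trans (cong coords e) (coords-vertex q))

  coords-injective : ∀ {x y} → coords x ≡ coords y → x ≡ y
  coords-injective {x} {y} e = trans (sym (vertex-coords x)) (trans (cong vertex e) (vertex-coords y))

  adj⇒∼ˡ : ∀ {p y} → Adj (G ⊠ H) (vertex p) y → p ∼ coords y
  adj⇒∼ˡ {p} = subst (_∼ _) (coords-vertex p)

  adj⇒∼ʳ : ∀ {x q} → Adj (G ⊠ H) x (vertex q) → coords x ∼ q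
  adj⇒∼ʳ {q = q} = subst (_ ∼_) (coords-vertex q)

  adj⇒∼ : ∀ {p q} → Adj (G ⊠ H) (vertex p) (vertex q) → p ∼ q
  adj⇒∼ {p} {q} = subst₂ _∼_ (coords-vertex p) (coords-vertex q)

  adj-vertex : ∀ {p q} → p ∼ q → Adj (G ⊠ H) (vertex p) (vertex q)
  adj-vertex {p} {q} = subst₂ _∼_ (sym (coords-vertex p)) (sym (coords-vertex q))

  chain⇒productPath : ∀ {x y} → Chain _∼_ (coords x) (coords y) → Path (G ⊠ H) x y
  chain⇒productPath {x} {y} (i , lk , un) =
    subst₂ (Path (G ⊠ H)) (vertex-coords x) (vertex-coords y)
      (mkPath (map vertex i)
        (subst (Linked _) (cong (_ ∷_) (map-++ vertex i _)) (Linked.map⁺ (Linked.map adj-vertex lk)))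
        (subst Unique (cong (_ ∷_) (map-++ vertex i _)) (Unique.map⁺ vertex-injective un)))

  internal-chain⇒productPath : ∀ {x y} (c : Chain _∼_ (coords x) (coords y)) →
                               internal (chain⇒productPath {x} {y} c) ≡ map vertex (proj₁ c)
  internal-chain⇒productPath {x} {y} c = lemma (vertex-coords x) (vertex-coords y)
    where
    lemma : ∀ {a b a' b'} (ea : a ≡ a') (eb : b ≡ b') {p : Path (G ⊠ H) a b} →
            internal (subst₂ (Path (G ⊠ H)) ea eb p) ≡ internal p
    lemma refl refl = refl

  len-chain⇒productPath : ∀ {x y} (c : Chain _∼_ (coords x) (coords y)) →
                          len (chain⇒productPath {x} {y} c) ≡ suc (length (proj₁ c))
  len-chain⇒productPath {x} {y} c =
    cong suc (trans (cong length (internal-chain⇒productPath {x} {y} c)) (length-map vertex (proj₁ c)))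

  proper-chain⇒productPath : ∀ {m} (c : Pair → Fin m) {x y} (p : Chain _∼_ (coords x) (coords y)) →
                             Linked (λ a b → c a ≢ c b) (proj₁ p) →
                             VertexProper {G ⊠ H} (λ z → c (coords z)) (chain⇒productPath {x} {y} p)
  proper-chain⇒productPath c {x} {y} p lk =
    subst (Linked _) (sym (internal-chain⇒productPath {x} {y} p))
      (Linked.map⁺ (Linked.map (λ {a} {b} c≢ e → c≢ (subst₂ (λ a' b' → c a' ≡ c b') (coords-vertex a) (coords-vertex b) e))
                               lk))

  dist-lower-boundᴳ : ∀ {g g' h h' d} → Dist G g g' d → (q : Path (G ⊠ H) (vertex (g , h)) (vertex (g' , h'))) → d ≤ len q
  dist-lower-boundᴳ {g} {g'} {h} {h'} D =
    dist-image-≤ (λ z → proj₁ (coords z)) (λ a → proj₁ (∼-proj a))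
      (subst₂ (λ a b → Dist G a b _) (sym (cong proj₁ (coords-vertex (g , h))))
                                     (sym (cong proj₁ (coords-vertex (g' , h')))) D)

  dist-lower-boundᴴ : ∀ {g g' h h' d} → Dist H h h' d → (q : Path (G ⊠ H) (vertex (g , h)) (vertex (g' , h'))) → d ≤ len q
  dist-lower-boundᴴ {g} {g'} {h} {h'} D =
    dist-image-≤ (λ z → proj₂ (coords z)) (λ a → proj₂ (∼-proj a))
      (subst₂ (λ a b → Dist H a b _) (sym (cong proj₂ (coords-vertex (g , h))))
                                     (sym (cong proj₂ (coords-vertex (g' , h')))) D)

  geodesic-lower-boundᴳ : ∀ {x y} (p : Path G (proj₁ (coords x)) (proj₁ (coords y))) → Geodesic p →
                          (q : Path (G ⊠ H) x y) → len p ≤ len q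
  geodesic-lower-boundᴳ = geodesic-image-≤ (λ z → proj₁ (coords z)) (λ a → proj₁ (∼-proj a))

  geodesic-lower-boundᴴ : ∀ {x y} (p : Path H (proj₂ (coords x)) (proj₂ (coords y))) → Geodesic p →
                          (q : Path (G ⊠ H) x y) → len p ≤ len q
  geodesic-lower-boundᴴ = geodesic-image-≤ (λ z → proj₂ (coords z)) (λ a → proj₂ (∼-proj a))

  disjointChains⇒family : ∀ {x y} → ((p , q , _) : DisjointChains _∼_ (coords x) (coords y)) →
                          DisjointFamily {G ⊠ H} 2 (pathPair (chain⇒productPath {x} {y} p) (chain⇒productPath {x} {y} q))
  disjointChains⇒family {x} {y} (p , q , (z , z∈p) , disjoint) =
    disjointFamily-pair (chain⇒productPath p) (chain⇒productPath q)
      (vertex z , subst (vertex z ∈_) (sym (internal-chain⇒productPath {x} {y} p)) (∈-map⁺ vertex z∈p))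
      disjoint'
    where
    disjoint' : ∀ w → w ∈ internal (chain⇒productPath {x} {y} p) → w ∉ internal (chain⇒productPath {x} {y} q)
    disjoint' w w∈p w∈q
      with ∈-map⁻ vertex (subst (w ∈_) (internal-chain⇒productPath {x} {y} p) w∈p)
         | ∈-map⁻ vertex (subst (w ∈_) (internal-chain⇒productPath {x} {y} q) w∈q)
    ... | a , a∈p , refl | b , b∈q , e = disjoint a a∈p (subst (_∈ proj₁ q) (sym (vertex-injective e)) b∈q)

-- Two disjoint properly coloured chains in the strong product

xor₂ : Fin 2 → Fin 2 → Fin 2
xor₂ fzero    b = b
xor₂ (fsuc _) b = flip₂ b

flip₂-≢ : ∀ b → b ≢ flip₂ b
flip₂-≢ fzero        ()
flip₂-≢ (fsuc fzero) ()

flip₂-injective : ∀ {a b} → flip₂ a ≡ flip₂ b → a ≡ b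
flip₂-injective {fzero}      {fzero}      _ = refl
flip₂-injective {fsuc fzero} {fsuc fzero} _ = refl
flip₂-injective {fzero}      {fsuc fzero} ()
flip₂-injective {fsuc fzero} {fzero}      ()

xor₂-≢ˡ : ∀ {a a'} b → a ≢ a' → xor₂ a b ≢ xor₂ a' b
xor₂-≢ˡ {fzero}      {fzero}      b a≢a' = ⊥-elim (a≢a' refl)
xor₂-≢ˡ {fzero}      {fsuc fzero} b _    = flip₂-≢ b
xor₂-≢ˡ {fsuc fzero} {fzero}      b _    = λ e → flip₂-≢ b (sym e)
xor₂-≢ˡ {fsuc fzero} {fsuc fzero} b a≢a' = ⊥-elim (a≢a' refl)

xor₂-≢ʳ : ∀ a {b b'} → b ≢ b' → xor₂ a b ≢ xor₂ a b'
xor₂-≢ʳ fzero    b≢b' = b≢b'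
xor₂-≢ʳ (fsuc _) b≢b' = λ e → b≢b' (flip₂-injective e)

module XorColouring (G H : Graph) (cG : Vtx G → Fin 2) (cG-proper : ProperlyConnected G cG)
                    (cH : Vtx H → Fin 2) (cH-proper : ProperlyConnected H cH)
                    (ntG : Nontrivial G) (ntH : Nontrivial H) where
  open StrongProduct G H

  colour : Pair → Fin 2
  colour (g , h) = xor₂ (cG g) (cH h)

  Step : Pair → Pair → Set
  Step x y = x ∼ y × colour x ≢ colour y

  row : Vtx H → Vtx G → Pair
  row h g = g , h

  column : Vtx G → Vtx H → Pair
  column g h = g , h

  row-linked : ∀ h {l} → Linked (ColourStep G cG) l → Linked Step (map (row h) l)
  row-linked h = Linked.map⁺ ∘′ Linked.map λ (a , c≢) → inj₁ (a , refl) , xor₂-≢ˡ (cH h) c≢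

  column-linked : ∀ g {l} → Linked (ColourStep H cH) l → Linked Step (map (column g) l)
  column-linked g = Linked.map⁺ ∘′ Linked.map λ (b , c≢) → inj₂ (inj₁ (refl , b)) , xor₂-≢ʳ (cG g) c≢

  row-unique : ∀ h {l} → Unique l → Unique (map (row h) l)
  row-unique h = Unique.map⁺ (cong proj₁)

  column-unique : ∀ g {l} → Unique l → Unique (map (column g) l)
  column-unique g = Unique.map⁺ (cong proj₂)

  ∈-row : ∀ {h z l} → z ∈ map (row h) l → proj₂ z ≡ h
  ∈-row {h} z∈ with ∈-map⁻ (row h) z∈
  ... | _ , _ , refl = refl

  ∈-column : ∀ {g z l} → z ∈ map (column g) l → proj₁ z ≡ g
  ∈-column {g} z∈ with ∈-map⁻ (column g) z∈
  ... | _ , _ , refl = refl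

  rowThenColumn : ∀ {g h} gs hs → Linked (ColourStep G cG) (g ∷ gs) → Unique (g ∷ gs) →
                  Linked (ColourStep H cH) (h ∷ hs) → Unique (h ∷ hs) →
                  let ys = map (row h) gs ++ map (column (lastOf g gs)) hs in
                  Linked Step ((g , h) ∷ ys) × Unique ((g , h) ∷ ys) × lastOf (g , h) ys ≡ (lastOf g gs , lastOf h hs)
  rowThenColumn {g} {h} gs hs lg ug lh uh = lk , un , ends
    where
    corner : lastOf (g , h) (map (row h) gs) ≡ (lastOf g gs , h)
    corner = lastOf-map (row h) g gs
    ys : List Pair
    ys = map (row h) gs ++ map (column (lastOf g gs)) hs
    lk : Linked Step ((g , h) ∷ ys)
    lk = linked-++ (g , h) (map (row h) gs) _ (row-linked h lg)
           (subst (λ z → Linked Step (z ∷ map (column _) hs)) (sym corner) (column-linked _ lh))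
    un : Unique ((g , h) ∷ ys)
    un = Unique.++⁺ (row-unique h ug) (column-unique _ (AllPairs.tail uh)) λ (z∈row , z∈column) →
           let (y , y∈ , z≡) = ∈-map⁻ (column _) z∈column
           in All.lookup (AllPairs.head uh) y∈ (sym (trans (cong proj₂ (sym z≡)) (∈-row z∈row)))
    ends : lastOf (g , h) ys ≡ (lastOf g gs , lastOf h hs)
    ends = trans (lastOf-++ _ (map (row h) gs) _)
             (trans (cong (λ z → lastOf z (map (column _) hs)) corner) (lastOf-map (column _) h hs))

  columnThenRow : ∀ {g h} gs hs → Linked (ColourStep G cG) (g ∷ gs) → Unique (g ∷ gs) →
                  Linked (ColourStep H cH) (h ∷ hs) → Unique (h ∷ hs) →
                  let ys = map (column g) hs ++ map (row (lastOf h hs)) gs in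
                  Linked Step ((g , h) ∷ ys) × Unique ((g , h) ∷ ys) × lastOf (g , h) ys ≡ (lastOf g gs , lastOf h hs)
  columnThenRow {g} {h} gs hs lg ug lh uh = lk , un , ends
    where
    corner : lastOf (g , h) (map (column g) hs) ≡ (g , lastOf h hs)
    corner = lastOf-map (column g) h hs
    ys : List Pair
    ys = map (column g) hs ++ map (row (lastOf h hs)) gs
    lk : Linked Step ((g , h) ∷ ys)
    lk = linked-++ (g , h) (map (column g) hs) _ (column-linked g lh)
           (subst (λ z → Linked Step (z ∷ map (row _) gs)) (sym corner) (row-linked _ lg))
    un : Unique ((g , h) ∷ ys)
    un = Unique.++⁺ (column-unique g uh) (row-unique _ (AllPairs.tail ug)) λ (z∈column , z∈row) →
           let (x , x∈ , z≡) = ∈-map⁻ (row _) z∈row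
           in All.lookup (AllPairs.head ug) x∈ (sym (trans (cong proj₁ (sym z≡)) (∈-column z∈column)))
    ends : lastOf (g , h) ys ≡ (lastOf g gs , lastOf h hs)
    ends = trans (lastOf-++ _ (map (column g) hs) _)
             (trans (cong (λ z → lastOf z (map (row _) gs)) corner) (lastOf-map (row _) g gs))

  -- One chain turns at the corner (g', h), the other at (g, h').
  disjointChains-corner : ∀ {g g' h h'} → g ≢ g' → h ≢ h' → DisjointChains Step (g , h) (g' , h')
  disjointChains-corner {g} {g'} {h} {h'} g≢g' h≢h' with cG-proper g g' g≢g' | cH-proper h h' h≢h'
  ... | gi , lg , ug | hi , lh , uh
    with rowThenColumn (gi ++ g' ∷ []) (hi ++ h' ∷ []) lg ug lh uh
       | columnThenRow (gi ++ g' ∷ []) (hi ++ h' ∷ []) lg ug lh uh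
  ... | lk₁ , un₁ , ends₁ | lk₂ , un₂ , ends₂
    with uniqueWalk⇒chain _ lk₁ un₁ (trans ends₁ ends) u≢v | uniqueWalk⇒chain _ lk₂ un₂ (trans ends₂ ends) u≢v
    where
    ends : (lastOf g (gi ++ g' ∷ []) , lastOf h (hi ++ h' ∷ [])) ≡ (g' , h')
    ends = cong₂ _,_ (lastOf-∷ʳ g gi g') (lastOf-∷ʳ h hi h')
    u≢v : (g , h) ≢ (g' , h')
    u≢v e = g≢g' (cong proj₁ e)
  ... | p , ys₁≡ | q , ys₂≡ = p , q , ((g' , h) , corner∈p) , disjoint
    where
    gs : List (Vtx G)
    gs = gi ++ g' ∷ []
    hs : List (Vtx H)
    hs = hi ++ h' ∷ []
    corner∈p : (g' , h) ∈ proj₁ p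
    corner∈p = ∈-init (proj₁ p) (subst ((g' , h) ∈_) ys₁≡ (∈-++⁺ˡ (∈-map⁺ (row h) (∈-++⁺ʳ gi (here refl)))))
                 λ e → h≢h' (cong proj₂ e)
    disjoint : ∀ z → z ∈ proj₁ p → z ∉ proj₁ q
    disjoint z z∈p z∈q
      with ∈-++⁻ (map (row h) gs) (subst (z ∈_) (sym ys₁≡) (∈-++⁺ˡ z∈p))
         | ∈-++⁻ (map (column g) hs) (subst (z ∈_) (sym ys₂≡) (∈-++⁺ˡ z∈q))
    ... | inj₁ z∈row | inj₁ z∈column = chain-internal-≢ˡ p z∈p (cong₂ _,_ (∈-column z∈column) (∈-row z∈row))
    ... | inj₁ z∈row | inj₂ z∈row'   = h≢h' (trans (sym (∈-row z∈row)) (trans (∈-row z∈row') (lastOf-∷ʳ h hi h')))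
    ... | inj₂ z∈column' | inj₁ z∈column =
      g≢g' (trans (sym (∈-column z∈column)) (trans (∈-column z∈column') (lastOf-∷ʳ g gi g')))
    ... | inj₂ z∈column' | inj₂ z∈row' = chain-internal-≢ʳ p z∈p
      (cong₂ _,_ (trans (∈-column z∈column') (lastOf-∷ʳ g gi g')) (trans (∈-row z∈row') (lastOf-∷ʳ h hi h')))

  columnDetour : ∀ {g g₁ h h'} hi → ColourStep G cG g g₁ →
                 Linked (ColourStep H cH) (h ∷ hi ++ h' ∷ []) → Unique (h ∷ hi ++ h' ∷ []) →
                 let ys = map (column g₁) (h ∷ hi ++ h' ∷ []) ++ (g , h') ∷ [] in
                 Linked Step ((g , h) ∷ ys) × Unique ((g , h) ∷ ys)
  columnDetour {g} {g₁} {h} {h'} hi (g~g₁ , c≢) lh uh = lk , un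
    where
    hs : List (Vtx H)
    hs = hi ++ h' ∷ []
    ys : List Pair
    ys = map (column g₁) (h ∷ hs) ++ (g , h') ∷ []
    g≢g₁ : g ≢ g₁
    g≢g₁ = adj⇒≢ {G} g~g₁
    lk : Linked Step ((g , h) ∷ ys)
    lk = (inj₁ (g~g₁ , refl) , xor₂-≢ˡ (cH h) c≢) ∷
         linked-++ (g₁ , h) (map (column g₁) hs) _ (column-linked g₁ lh)
           (subst (λ z → Linked Step (z ∷ (g , h') ∷ []))
             (sym (trans (lastOf-map (column g₁) h hs) (cong (column g₁) (lastOf-∷ʳ h hi h'))))
             ((inj₁ (adjSym G g~g₁ , refl) , xor₂-≢ˡ (cH h') (λ e → c≢ (sym e))) ∷ [-]))
    start∉ : ∀ {z} → z ∈ ys → (g , h) ≢ z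
    start∉ z∈ e with ∈-++⁻ (map (column g₁) (h ∷ hs)) z∈
    ... | inj₁ z∈column = g≢g₁ (trans (cong proj₁ e) (∈-column z∈column))
    ... | inj₂ (here refl) = All.lookup (AllPairs.head uh) (∈-++⁺ʳ hi (here refl)) (cong proj₂ e)
    un : Unique ((g , h) ∷ ys)
    un = All.tabulate start∉ ∷
         Unique.++⁺ (column-unique g₁ uh) ([] ∷ []) λ { (z∈ , here refl) → g≢g₁ (∈-column z∈) }

  rowDetour : ∀ {g g' h h₁} gi → ColourStep H cH h h₁ →
              Linked (ColourStep G cG) (g ∷ gi ++ g' ∷ []) → Unique (g ∷ gi ++ g' ∷ []) →
              let ys = map (row h₁) (g ∷ gi ++ g' ∷ []) ++ (g' , h) ∷ [] in
              Linked Step ((g , h) ∷ ys) × Unique ((g , h) ∷ ys)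
  rowDetour {g} {g'} {h} {h₁} gi (h~h₁ , c≢) lg ug = lk , un
    where
    gs : List (Vtx G)
    gs = gi ++ g' ∷ []
    ys : List Pair
    ys = map (row h₁) (g ∷ gs) ++ (g' , h) ∷ []
    h≢h₁ : h ≢ h₁
    h≢h₁ = adj⇒≢ {H} h~h₁
    lk : Linked Step ((g , h) ∷ ys)
    lk = (inj₂ (inj₁ (refl , h~h₁)) , xor₂-≢ʳ (cG g) c≢) ∷
         linked-++ (g , h₁) (map (row h₁) gs) _ (row-linked h₁ lg)
           (subst (λ z → Linked Step (z ∷ (g' , h) ∷ []))
             (sym (trans (lastOf-map (row h₁) g gs) (cong (row h₁) (lastOf-∷ʳ g gi g'))))
             ((inj₂ (inj₁ (refl , adjSym H h~h₁)) , xor₂-≢ʳ (cG g') (λ e → c≢ (sym e))) ∷ [-]))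
    start∉ : ∀ {z} → z ∈ ys → (g , h) ≢ z
    start∉ z∈ e with ∈-++⁻ (map (row h₁) (g ∷ gs)) z∈
    ... | inj₁ z∈row = h≢h₁ (trans (cong proj₂ e) (∈-row z∈row))
    ... | inj₂ (here refl) = All.lookup (AllPairs.head ug) (∈-++⁺ʳ gi (here refl)) (cong proj₁ e)
    un : Unique ((g , h) ∷ ys)
    un = All.tabulate start∉ ∷
         Unique.++⁺ (row-unique h₁ ug) ([] ∷ []) λ { (z∈ , here refl) → h≢h₁ (∈-row z∈) }

  disjointChains-column : ∀ {g h h'} → h ≢ h' → DisjointChains Step (g , h) (g , h')
  disjointChains-column {g} {h} {h'} h≢h' with cH-proper h h' h≢h' | another ntG g
  ... | hi , lh , uh | o , g≢o with chain-first (cG-proper g o g≢o)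
  ... | g₁ , step@(g~g₁ , _) with columnDetour hi step lh uh
  ... | lk , un
    with uniqueWalk⇒chain _ lk un (lastOf-∷ʳ (g , h) (map (column g₁) (h ∷ hi ++ h' ∷ [])) (g , h')) u≢v
       | uniqueWalk⇒chain (map (column g) (hi ++ h' ∷ [])) (column-linked g lh) (column-unique g uh)
           (trans (lastOf-map (column g) h (hi ++ h' ∷ [])) (cong (column g) (lastOf-∷ʳ h hi h'))) u≢v
    where
    u≢v : (g , h) ≢ (g , h')
    u≢v e = h≢h' (cong proj₂ e)
  ... | p , detour≡ | q , straight≡ = p , q , ((g₁ , h) , turn∈p) , disjoint
    where
    g≢g₁ : g ≢ g₁
    g≢g₁ = adj⇒≢ {G} g~g₁
    turn∈p : (g₁ , h) ∈ proj₁ p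
    turn∈p = ∈-init (proj₁ p) (subst ((g₁ , h) ∈_) detour≡ (here refl)) λ e → g≢g₁ (sym (cong proj₁ e))
    disjoint : ∀ z → z ∈ proj₁ p → z ∉ proj₁ q
    disjoint z z∈p z∈q with ∈-++⁻ (map (column g₁) (h ∷ hi ++ h' ∷ [])) (subst (z ∈_) (sym detour≡) (∈-++⁺ˡ z∈p))
    ... | inj₁ z∈column =
      g≢g₁ (trans (sym (∈-column (subst (z ∈_) (sym straight≡) (∈-++⁺ˡ z∈q)))) (∈-column z∈column))
    ... | inj₂ (here z≡v) = chain-internal-≢ʳ p z∈p z≡v

  disjointChains-row : ∀ {g g' h} → g ≢ g' → DisjointChains Step (g , h) (g' , h)
  disjointChains-row {g} {g'} {h} g≢g' with cG-proper g g' g≢g' | another ntH h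
  ... | gi , lg , ug | o , h≢o with chain-first (cH-proper h o h≢o)
  ... | h₁ , step@(h~h₁ , _) with rowDetour gi step lg ug
  ... | lk , un
    with uniqueWalk⇒chain _ lk un (lastOf-∷ʳ (g , h) (map (row h₁) (g ∷ gi ++ g' ∷ [])) (g' , h)) u≢v
       | uniqueWalk⇒chain (map (row h) (gi ++ g' ∷ [])) (row-linked h lg) (row-unique h ug)
           (trans (lastOf-map (row h) g (gi ++ g' ∷ [])) (cong (row h) (lastOf-∷ʳ g gi g'))) u≢v
    where
    u≢v : (g , h) ≢ (g' , h)
    u≢v e = g≢g' (cong proj₁ e)
  ... | p , detour≡ | q , straight≡ = p , q , ((g , h₁) , turn∈p) , disjoint
    where
    h≢h₁ : h ≢ h₁
    h≢h₁ = adj⇒≢ {H} h~h₁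
    turn∈p : (g , h₁) ∈ proj₁ p
    turn∈p = ∈-init (proj₁ p) (subst ((g , h₁) ∈_) detour≡ (here refl)) λ e → h≢h₁ (sym (cong proj₂ e))
    disjoint : ∀ z → z ∈ proj₁ p → z ∉ proj₁ q
    disjoint z z∈p z∈q with ∈-++⁻ (map (row h₁) (g ∷ gi ++ g' ∷ [])) (subst (z ∈_) (sym detour≡) (∈-++⁺ˡ z∈p))
    ... | inj₁ z∈row = h≢h₁ (trans (sym (∈-row (subst (z ∈_) (sym straight≡) (∈-++⁺ˡ z∈q)))) (∈-row z∈row))
    ... | inj₂ (here z≡v) = chain-internal-≢ʳ p z∈p z≡v

  disjointChains : ∀ u v → u ≢ v → DisjointChains Step u v
  disjointChains (g , h) (g' , h') u≢v with g ≟ᶠ g' | h ≟ᶠ h'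
  ... | yes refl | yes refl = ⊥-elim (u≢v refl)
  ... | yes refl | no  h≢h' = disjointChains-column h≢h'
  ... | no  g≢g' | yes refl = disjointChains-row g≢g'
  ... | no  g≢g' | no  h≢h' = disjointChains-corner g≢g' h≢h'

  colouring : Coloring (G ⊠ H) 2
  colouring z = colour (coords z)

  proper-2-connected : ProperVertexKConnected (G ⊠ H) 2 colouring
  proper-2-connected x y x≢y with disjointChains (coords x) (coords y) (λ e → x≢y (coords-injective e))
  ... | p , q , z∈p , disjoint =
    pathPair (path p) (path q) , disjointChains⇒family (chain-map proj₁ p , chain-map proj₁ q , z∈p , disjoint) ,
    λ { fzero → proper p ; (fsuc _) → proper q }
    where
    path : Chain Step (coords x) (coords y) → Path (G ⊠ H) x y
    path c = chain⇒productPath (chain-map proj₁ c)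
    proper : (c : Chain Step (coords x) (coords y)) → VertexProper colouring (path c)
    proper c = proper-chain⇒productPath colour (chain-map proj₁ c) (Linked.map proj₂ (chain-internal-linked c))

-- Geodesics in the strong product

module _ {A B : Set} where

  zip-linked : ∀ {R : A → A → Set} {S : B → B → Set} {T : A × B → A × B → Set} →
               (∀ {a a' b b'} → R a a' → S b b' → T (a , b) (a' , b')) →
               ∀ {as bs} → Linked R as → Linked S bs → length as ≡ length bs → Linked T (zip as bs)
  zip-linked f {[]}          {[]}          _        _        _  = []
  zip-linked f {_ ∷ []}      {_ ∷ []}      _        _        _  = [-]
  zip-linked f {_ ∷ _ ∷ _}   {_ ∷ _ ∷ _}   (r ∷ lr) (s ∷ ls) e  = f r s ∷ zip-linked f lr ls (suc-injective e)
  zip-linked f {[]}          {_ ∷ _}       _        _        ()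
  zip-linked f {_ ∷ _}       {[]}          _        _        ()
  zip-linked f {_ ∷ []}      {_ ∷ _ ∷ _}   _        _        ()
  zip-linked f {_ ∷ _ ∷ _}   {_ ∷ []}      _        _        ()

  zip-linkedˡ : ∀ {R : A → A → Set} {as} (bs : List B) → Linked R as → Linked (λ x y → R (proj₁ x) (proj₁ y)) (zip as bs)
  zip-linkedˡ {as = _ ∷ _ ∷ _} (_ ∷ _ ∷ bs) (r ∷ lr) = r ∷ zip-linkedˡ (_ ∷ bs) lr
  zip-linkedˡ {as = []}        _            _        = []
  zip-linkedˡ {as = _ ∷ []}    []           _        = []
  zip-linkedˡ {as = _ ∷ []}    (_ ∷ _)      _        = [-]
  zip-linkedˡ {as = _ ∷ _ ∷ _} []           _        = []
  zip-linkedˡ {as = _ ∷ _ ∷ _} (_ ∷ [])     _        = [-]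

  zip-linkedʳ : ∀ {S : B → B → Set} (as : List A) {bs} → Linked S bs → Linked (λ x y → S (proj₂ x) (proj₂ y)) (zip as bs)
  zip-linkedʳ (_ ∷ _ ∷ as) {_ ∷ _ ∷ _} (s ∷ ls) = s ∷ zip-linkedʳ (_ ∷ as) ls
  zip-linkedʳ []           {_}         _        = []
  zip-linkedʳ (_ ∷ _)      {[]}        _        = []
  zip-linkedʳ (_ ∷ [])     {_ ∷ _}     _        = [-]
  zip-linkedʳ (_ ∷ _ ∷ _)  {_ ∷ []}    _        = [-]

  all-zipˡ : ∀ {P : A → Set} {as} (bs : List B) → All P as → All (λ x → P (proj₁ x)) (zip as bs)
  all-zipˡ bs       []         = []
  all-zipˡ []       (_ ∷ _)    = []
  all-zipˡ (_ ∷ bs) (pa ∷ pas) = pa ∷ all-zipˡ bs pas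

  all-zipʳ : ∀ {P : B → Set} (as : List A) {bs} → All P bs → All (λ x → P (proj₂ x)) (zip as bs)
  all-zipʳ []       _          = []
  all-zipʳ (_ ∷ _)  []         = []
  all-zipʳ (_ ∷ as) (pb ∷ pbs) = pb ∷ all-zipʳ as pbs

  zip-uniqueˡ : ∀ {as} (bs : List B) → Unique as → Unique (zip as bs)
  zip-uniqueˡ bs       []        = []
  zip-uniqueˡ []       (_ ∷ _)   = []
  zip-uniqueˡ (_ ∷ bs) (a∉ ∷ un) =
    All.map (λ a≢ e → a≢ (cong proj₁ e)) (all-zipˡ {P = _ ≢_} bs a∉) ∷ zip-uniqueˡ bs un

  zip-uniqueʳ : ∀ (as : List A) {bs : List B} → Unique bs → Unique (zip as bs)
  zip-uniqueʳ []       _         = []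
  zip-uniqueʳ (_ ∷ _)  []        = []
  zip-uniqueʳ (_ ∷ as) (b∉ ∷ un) =
    All.map (λ b≢ e → b≢ (cong proj₂ e)) (all-zipʳ {P = _ ≢_} as b∉) ∷ zip-uniqueʳ as un

  zip-∷ʳ : ∀ (as : List A) (bs : List B) a b → length as ≡ length bs →
           zip (as ++ a ∷ []) (bs ++ b ∷ []) ≡ zip as bs ++ (a , b) ∷ []
  zip-∷ʳ []       []       a b _ = refl
  zip-∷ʳ (x ∷ as) (y ∷ bs) a b e = cong ((x , y) ∷_) (zip-∷ʳ as bs a b (suc-injective e))

  length-zip : ∀ (as : List A) (bs : List B) → length as ≡ length bs → length (zip as bs) ≡ length as
  length-zip []       []       _ = refl
  length-zip (_ ∷ as) (_ ∷ bs) e = cong suc (length-zip as bs (suc-injective e))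

-- A walk of exactly k + 1 steps, each of which may also stay put.
LazyWalk : (K : Graph) → Vtx K → Vtx K → ℕ → Set
LazyWalk K a b k = Σ (List (Vtx K)) λ ms → length ms ≡ k × Linked (AdjOrEq K) (a ∷ ms ++ b ∷ [])

linked-replicate : ∀ {K} (b : Vtx K) r → Linked (AdjOrEq K) (b ∷ replicate r b)
linked-replicate b zero    = [-]
linked-replicate {K} b (suc r) = inj₁ refl ∷ linked-replicate {K} b r

replicate-∷ʳ : ∀ {A : Set} r (b : A) → b ∷ replicate r b ≡ replicate r b ++ b ∷ []
replicate-∷ʳ zero    b = refl
replicate-∷ʳ (suc r) b = cong (b ∷_) (replicate-∷ʳ r b)

lazyWalk-stay : ∀ {K} (a : Vtx K) k → LazyWalk K a a k
lazyWalk-stay {K} a k =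
  replicate k a , length-replicate k , subst (λ l → Linked _ (a ∷ l)) (replicate-∷ʳ k a) (linked-replicate {K} a (suc k))

lazyWalk-path : ∀ {K a b} (p : Path K a b) k → len p ≤ suc k → LazyWalk K a b k
lazyWalk-path {K} {a} {b} (mkPath i lk _) k len≤ =
  i ++ replicate r b ,
  trans (length-++ i) (trans (cong (length i +_) (length-replicate r)) (m+[n∸m]≡n (≤-pred len≤))) ,
  subst (λ l → Linked (AdjOrEq K) (a ∷ l)) reassociate
    (linked-++ a (i ++ b ∷ []) (replicate r b) (Linked.map inj₂ lk)
      (subst (λ z → Linked _ (z ∷ replicate r b)) (sym (lastOf-∷ʳ a i b)) (linked-replicate {K} b r)))
  where
  r : ℕ
  r = k ∸ length i
  reassociate : (i ++ b ∷ []) ++ replicate r b ≡ (i ++ replicate r b) ++ b ∷ []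
  reassociate = trans (++-assoc i (b ∷ []) (replicate r b))
                  (trans (cong (i ++_) (replicate-∷ʳ r b)) (sym (++-assoc i (replicate r b) (b ∷ []))))

module ProductGeodesics (G H : Graph) where
  open StrongProduct G H

  ledByᴳ : ∀ {g g' h h'} (p : Path G g g') → LazyWalk H h h' (length (internal p)) → Chain _∼_ (g , h) (g' , h')
  ledByᴳ {g} {g'} {h} {h'} (mkPath gi lg ug) (hs , len-hs , lh) =
    zip gi hs ,
    subst (λ l → Linked _ ((g , h) ∷ l)) zip≡ (zip-linked ∼-introᴳ lg lh (cong suc same-length)) ,
    subst (λ l → Unique ((g , h) ∷ l)) zip≡ (zip-uniqueˡ (h ∷ hs ++ h' ∷ []) ug)
    where
    same-length : length (gi ++ g' ∷ []) ≡ length (hs ++ h' ∷ [])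
    same-length = trans (length-∷ʳ gi g') (trans (cong suc (sym len-hs)) (sym (length-∷ʳ hs h')))
    zip≡ : zip (gi ++ g' ∷ []) (hs ++ h' ∷ []) ≡ zip gi hs ++ (g' , h') ∷ []
    zip≡ = zip-∷ʳ gi hs g' h' (sym len-hs)

  ledByᴴ : ∀ {g g' h h'} (p : Path H h h') → LazyWalk G g g' (length (internal p)) → Chain _∼_ (g , h) (g' , h')
  ledByᴴ {g} {g'} {h} {h'} (mkPath hi lh uh) (gs , len-gs , lg) =
    zip gs hi ,
    subst (λ l → Linked _ ((g , h) ∷ l)) zip≡ (zip-linked ∼-introᴴ lg lh (cong suc same-length)) ,
    subst (λ l → Unique ((g , h) ∷ l)) zip≡ (zip-uniqueʳ (g ∷ gs ++ g' ∷ []) uh)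
    where
    same-length : length (gs ++ g' ∷ []) ≡ length (hi ++ h' ∷ [])
    same-length = trans (length-∷ʳ gs g') (trans (cong suc len-gs) (sym (length-∷ʳ hi h')))
    zip≡ : zip (gs ++ g' ∷ []) (hi ++ h' ∷ []) ≡ zip gs hi ++ (g' , h') ∷ []
    zip≡ = zip-∷ʳ gs hi g' h' len-gs

  geodesic-ledByᴳ : ∀ {x y} (p : Path G (proj₁ (coords x)) (proj₁ (coords y))) → Geodesic p →
                    (w : LazyWalk H (proj₂ (coords x)) (proj₂ (coords y)) (length (internal p))) →
                    Geodesic (chain⇒productPath {x} {y} (ledByᴳ p w))
  geodesic-ledByᴳ {x} {y} p@(mkPath gi _ _) geo w@(hs , len-hs , _) q = begin
    len (chain⇒productPath {x} {y} (ledByᴳ p w)) ≡⟨ len-chain⇒productPath {x} {y} (ledByᴳ p w) ⟩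
    suc (length (zip gi hs))                      ≡⟨ cong suc (length-zip gi hs (sym len-hs)) ⟩
    len p                                         ≤⟨ geodesic-lower-boundᴳ p geo q ⟩
    len q                                         ∎
    where open ≤-Reasoning

  geodesic-ledByᴴ : ∀ {x y} (p : Path H (proj₂ (coords x)) (proj₂ (coords y))) → Geodesic p →
                    (w : LazyWalk G (proj₁ (coords x)) (proj₁ (coords y)) (length (internal p))) →
                    Geodesic (chain⇒productPath {x} {y} (ledByᴴ p w))
  geodesic-ledByᴴ {x} {y} p@(mkPath hi _ _) geo w@(gs , len-gs , _) q = begin
    len (chain⇒productPath {x} {y} (ledByᴴ p w)) ≡⟨ len-chain⇒productPath {x} {y} (ledByᴴ p w) ⟩
    suc (length (zip gs hi))                      ≡⟨ cong suc (trans (length-zip gs hi len-gs) len-gs) ⟩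
    len p                                         ≤⟨ geodesic-lower-boundᴴ p geo q ⟩
    len q                                         ∎
    where open ≤-Reasoning

module ProductColouring (G H : Graph) {b c} (cG : Coloring G b) (cH : Coloring H c) where
  open StrongProduct G H
  open ProductGeodesics G H

  colour : Pair → Fin (b * c)
  colour (g , h) = combine (cG g) (cH h)

  colouring : Coloring (G ⊠ H) (b * c)
  colouring z = colour (coords z)

  StrongRoute : Vtx (G ⊠ H) → Vtx (G ⊠ H) → Set
  StrongRoute x y = Σ (Path (G ⊠ H) x y) λ p → Geodesic p × VertexProper colouring p

  routeᴳ : ∀ {x y} (p : Path G (proj₁ (coords x)) (proj₁ (coords y))) → Geodesic p → VertexProper cG p →
           LazyWalk H (proj₂ (coords x)) (proj₂ (coords y)) (length (internal p)) → StrongRoute x y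
  routeᴳ {x} {y} p@(mkPath _ _ _) geo proper w@(hs , _) =
    chain⇒productPath (ledByᴳ p w) , geodesic-ledByᴳ p geo w ,
    proper-chain⇒productPath colour (ledByᴳ p w)
      (Linked.map (λ c≢ e → c≢ (combine-injectiveˡ {m = b} _ _ _ _ e)) (zip-linkedˡ hs proper))

  routeᴴ : ∀ {x y} (p : Path H (proj₂ (coords x)) (proj₂ (coords y))) → Geodesic p → VertexProper cH p →
           LazyWalk G (proj₁ (coords x)) (proj₁ (coords y)) (length (internal p)) → StrongRoute x y
  routeᴴ {x} {y} p@(mkPath _ _ _) geo proper w@(gs , _) =
    chain⇒productPath (ledByᴴ p w) , geodesic-ledByᴴ p geo w ,
    proper-chain⇒productPath colour (ledByᴴ p w)
      (Linked.map (λ c≢ e → c≢ (combine-injectiveʳ {m = b} _ _ _ _ e)) (zip-linkedʳ gs proper))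

  -- The factor at larger distance leads; the other one waits.
  strong-product : StrongProperVertexConnected G cG → StrongProperVertexConnected H cH →
                   StrongProperVertexConnected (G ⊠ H) colouring
  strong-product spG spH x y x≢y with proj₁ (coords x) ≟ᶠ proj₁ (coords y) | proj₂ (coords x) ≟ᶠ proj₂ (coords y)
  ... | yes g≡g' | yes h≡h' = ⊥-elim (x≢y (coords-injective (cong₂ _,_ g≡g' h≡h')))
  ... | no  g≢g' | yes h≡h' with spG _ _ g≢g'
  ...   | pG , geo , proper = routeᴳ pG geo proper (subst (λ h' → LazyWalk H _ h' _) h≡h' (lazyWalk-stay {H} _ _))
  strong-product spG spH x y x≢y | yes g≡g' | no h≢h' with spH _ _ h≢h'
  ...   | pH , geo , proper = routeᴴ pH geo proper (subst (λ g' → LazyWalk G _ g' _) g≡g' (lazyWalk-stay {G} _ _))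
  strong-product spG spH x y x≢y | no g≢g' | no h≢h' with spG _ _ g≢g' | spH _ _ h≢h'
  ... | pG , geoG , properG | pH , geoH , properH with len pH ≤? len pG
  ...   | yes pH≤pG = routeᴳ pG geoG properG (lazyWalk-path pH _ pH≤pG)
  ...   | no  pH≰pG = routeᴴ pH geoH properH (lazyWalk-path pG _ (<⇒≤ (≰⇒> pH≰pG)))

-- Existence of spvc

module StrongColouringSearch {K : Graph} (adj? : ∀ u v → Dec (Adj K u v)) (C : Connected K) where

  dist : ∀ u v → ∃[ d ] Dist K u v d
  dist = dist-total adj? C

  -- A vertex-proper geodesic, described by its internal vertices, of which there are d(u,v) - 1.
  ProperGeodesic : ∀ {m} → Coloring K m → Vtx K → Vtx K → Set
  ProperGeodesic c u v =
    u ≡ v ⊎ ∃ λ i → length i ≡ pred (proj₁ (dist u v)) ×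
                     (Linked (Adj K) (u ∷ i ++ v ∷ []) × Unique (u ∷ i ++ v ∷ [])) × Linked (λ a b → c a ≢ c b) i

  properGeodesic? : ∀ {m} (c : Coloring K m) u v → Dec (ProperGeodesic c u v)
  properGeodesic? c u v =
    (u ≟ᶠ v) ⊎-dec any-list? (pred (proj₁ (dist u v))) λ i →
      (Linked.linked? adj? (u ∷ i ++ v ∷ []) ×-dec UniqueDec.unique? _≟ᶠ_ (u ∷ i ++ v ∷ []))
      ×-dec Linked.linked? (λ a b → ¬? (c a ≟ᶠ c b)) i

  properGeodesic-resp : ∀ {m} {c c' : Coloring K m} → (∀ x → c x ≡ c' x) →
                        (∀ u v → ProperGeodesic c u v) → ∀ u v → ProperGeodesic c' u v
  properGeodesic-resp c≗c' pg u v with pg u v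
  ... | inj₁ u≡v = inj₁ u≡v
  ... | inj₂ (i , len-i , path , proper) =
    inj₂ (i , len-i , path , Linked.map (λ {a} {b} c≢ e → c≢ (trans (c≗c' a) (trans e (sym (c≗c' b))))) proper)

  strong⇔properGeodesics : ∀ {m} (c : Coloring K m) →
                           (StrongProperVertexConnected K c → ∀ u v → ProperGeodesic c u v)
                         × ((∀ u v → ProperGeodesic c u v) → StrongProperVertexConnected K c)
  strong⇔properGeodesics c = to , from
    where
    to : StrongProperVertexConnected K c → ∀ u v → ProperGeodesic c u v
    to spc u v = decide (u ≟ᶠ v)
      where
      decide : Dec (u ≡ v) → ProperGeodesic c u v
      decide (yes u≡v) = inj₁ u≡v
      decide (no  u≢v) with spc u v u≢v | dist⇒geodesic (proj₂ (dist u v)) u≢v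
      ... | p , geo , proper | p₀ , _ , len-p₀ =
        inj₂ (internal p ,
              cong pred (≤-antisym (≤-trans (geo p₀) (≤-reflexive len-p₀)) (dist-≤-len (proj₂ (dist u v)) p)) ,
              (linked p , unique p) , proper)
    from : (∀ u v → ProperGeodesic c u v) → StrongProperVertexConnected K c
    from pg u v u≢v with pg u v
    ... | inj₁ u≡v = ⊥-elim (u≢v u≡v)
    ... | inj₂ (i , len-i , (lk , un) , proper) with dist⇒geodesic (proj₂ (dist u v)) u≢v
    ...   | p₀ , geo , len-p₀ =
      mkPath i lk un , (λ q → subst (_≤ len q) (sym same-length) (geo q)) , proper
      where
      same-length : suc (length i) ≡ len p₀
      same-length = cong suc (trans len-i (cong pred (sym len-p₀)))

  strongColourable? : ∀ m → Dec (Σ (Coloring K m) (StrongProperVertexConnected K))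
  strongColourable? m with any-function? (n K) m (λ c → all? (λ u → all? (properGeodesic? c u))) properGeodesic-resp
  ... | yes (c , pg) = yes (c , proj₂ (strong⇔properGeodesics c) pg)
  ... | no  none     = no λ (c , spc) → none (c , proj₁ (strong⇔properGeodesics c) spc)

  distinct-colours : StrongProperVertexConnected K (λ x → x)
  distinct-colours u v u≢v with dist⇒geodesic (proj₂ (dist u v)) u≢v
  ... | p , geo , _ = p , geo , chain-internal-linked (internal p , Linked.AllPairs⇒Linked (unique p) , unique p)

  complete? : Dec (Complete K)
  complete? with all? (λ u → all? (λ v → (u ≟ᶠ v) ⊎-dec adj? u v))
  ... | yes adjOrEq  = yes (adjOrEq⇒complete {K} adjOrEq)
  ... | no  ¬adjOrEq = no λ complete → ¬adjOrEq (complete⇒adjOrEq {K} complete)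

  spvc-exists : ∃ (Spvc K)
  spvc-exists with complete?
  ... | yes complete = 0 , inj₁ (complete , refl)
  ... | no  ¬complete = proj₁ least , inj₂ (¬complete , proj₂ least)
    where
    least : ∃ (IsLeast λ m → Σ (Coloring K m) (StrongProperVertexConnected K))
    least = least-such strongColourable? (n K) ((λ x → x) , distinct-colours)

Spvc-≤ : ∀ {K a m} → Spvc K a → ¬ Complete K → Σ (Coloring K m) (StrongProperVertexConnected K) → a ≤ m
Spvc-≤ (inj₁ (complete , _))   ¬complete _  = ⊥-elim (¬complete complete)
Spvc-≤ (inj₂ (_ , _ , least)) _         sc = ≮⇒≥ λ m<a → least _ m<a sc

module ProductBounds (G H : Graph) (ntG : Nontrivial G) (ntH : Nontrivial H) where
  open StrongProduct G H

  g₀ : Vtx G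
  g₀ = vertex₀ ntG

  h₀ : Vtx H
  h₀ = vertex₀ ntH

  complete-⊠ : Complete G → Complete H → Complete (G ⊠ H)
  complete-⊠ completeG completeH x y x≢y =
    ∼-intro (complete⇒adjOrEq {G} completeG _ _) (complete⇒adjOrEq {H} completeH _ _) λ e → x≢y (coords-injective e)

  complete-⊠⁻ : Complete (G ⊠ H) → Complete G × Complete H
  complete-⊠⁻ complete = completeG , completeH
    where
    completeG : Complete G
    completeG u v u≢v =
      adjOrEq-≢ {G} (proj₁ (∼-proj (adj⇒∼ (complete (vertex (u , h₀)) (vertex (v , h₀)) u≢v′)))) u≢v
      where u≢v′ = λ e → u≢v (cong proj₁ (vertex-injective e))
    completeH : Complete H
    completeH u v u≢v =
      adjOrEq-≢ {H} (proj₂ (∼-proj (adj⇒∼ (complete (vertex (g₀ , u)) (vertex (g₀ , v)) u≢v′)))) u≢v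
      where u≢v′ = λ e → u≢v (cong proj₂ (vertex-injective e))

  dist2⇒¬complete-⊠ : (∃[ u ] ∃[ v ] Dist G u v 2) ⊎ (∃[ u ] ∃[ v ] Dist H u v 2) → ¬ Complete (G ⊠ H)
  dist2⇒¬complete-⊠ (inj₁ (u , v , D)) complete =
    dist2⇒¬AdjOrEq {G} D (complete⇒adjOrEq {G} (proj₁ (complete-⊠⁻ complete)) u v)
  dist2⇒¬complete-⊠ (inj₂ (u , v , D)) complete =
    dist2⇒¬AdjOrEq {H} D (complete⇒adjOrEq {H} (proj₂ (complete-⊠⁻ complete)) u v)

  farPair-⊠ : DiamGe3 G ⊎ DiamGe3 H → FarPair (G ⊠ H)
  farPair-⊠ (inj₁ (zero , () , _))
  farPair-⊠ (inj₂ (zero , () , _))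
  farPair-⊠ (inj₁ (suc d , 3≤d , _ , u , v , D)) =
    vertex (u , h₀) , vertex (v , h₀) , (λ e → dist-suc⇒≢ {G} D (cong proj₁ (vertex-injective e))) ,
    λ q → ≤-trans 3≤d (dist-lower-boundᴳ D q)
  farPair-⊠ (inj₂ (suc d , 3≤d , _ , u , v , D)) =
    vertex (g₀ , u) , vertex (g₀ , v) , (λ e → dist-suc⇒≢ {H} D (cong proj₂ (vertex-injective e))) ,
    λ q → ≤-trans 3≤d (dist-lower-boundᴴ D q)

  -- Both centres are forced, so two vertex-proper monochrome paths would share their only internal vertex.
  propP⇒¬monochrome-2-connected : PropP G → PropP H → ¬ Σ (Coloring (G ⊠ H) 1) (ProperVertexKConnected (G ⊠ H) 2)
  propP⇒¬monochrome-2-connected (u , v , Duv , w , _ , only-w) (a , b , Dab , z , _ , only-z) (c , pc)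
    with pc (vertex (u , a)) (vertex (v , b)) (λ e → dist2⇒¬AdjOrEq {G} Duv (inj₁ (cong proj₁ (vertex-injective e))))
  ... | ps , family , proper =
    proj₁ (family fzero (fsuc fzero) λ ()) (trans (via-centres fzero) (sym (via-centres (fsuc fzero))))
    where
    through-centres : (p : Path (G ⊠ H) (vertex (u , a)) (vertex (v , b))) → len p ≤ 2 → internal p ≡ vertex (w , z) ∷ []
    through-centres (mkPath [] (e ∷ _) _) _ = ⊥-elim (dist2⇒¬AdjOrEq {G} Duv (proj₁ (∼-proj (adj⇒∼ e))))
    through-centres (mkPath (m ∷ []) (e₁ ∷ e₂ ∷ _) _) _ =
      cong (_∷ []) (trans (sym (vertex-coords m)) (cong vertex (cong₂ _,_
        (unique-centre Duv only-w (proj₁ (∼-proj (adj⇒∼ˡ e₁))) (proj₁ (∼-proj (adj⇒∼ʳ e₂))))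
        (unique-centre Dab only-z (proj₂ (∼-proj (adj⇒∼ˡ e₁))) (proj₂ (∼-proj (adj⇒∼ʳ e₂)))))))
    through-centres (mkPath (_ ∷ _ ∷ _) _ _) (s≤s (s≤s ()))
    via-centres : ∀ i → internal (ps i) ≡ vertex (w , z) ∷ []
    via-centres i = through-centres (ps i) (one-colour-proper⇒short c (ps i) (proper i))

another-middle : ∀ {K a b} → Nontrivial K → Connected K → AdjOrEq K a b → ∃ λ k → a ≢ k × AdjOrEq K a k × AdjOrEq K k b
another-middle {K} nt C (inj₁ refl) with neighbour nt C _
... | k , a~k = k , adj⇒≢ {K} a~k , inj₂ a~k , inj₂ (adjSym K a~k)
another-middle {K} nt C (inj₂ a~b) = _ , adj⇒≢ {K} a~b , inj₂ a~b , inj₁ refl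

module ShortChains (G H : Graph) (ntG : Nontrivial G) (ntH : Nontrivial H) (CG : Connected G) (CH : Connected H)
                   (diamG : DiamLe2 G) (diamH : DiamLe2 H) where
  open StrongProduct G H

  ShortDisjointChains : Pair → Pair → Set
  ShortDisjointChains u v = Σ (DisjointChains _∼_ u v) λ (p , q , _) → length (proj₁ p) ≤ 1 × length (proj₁ q) ≤ 1

  via : ∀ {u m v} → u ∼ m → m ∼ v → u ≢ v → Chain _∼_ u v
  via r₁ r₂ u≢v = twoEdgeChain r₁ r₂ (∼-≢ r₁) u≢v (∼-≢ r₂)

  edge-and-via : ∀ {u m v} → u ∼ v → u ∼ m → m ∼ v → ShortDisjointChains u v
  edge-and-via r r₁ r₂ = (via r₁ r₂ (∼-≢ r) , edgeChain r (∼-≢ r) , (_ , here refl) , λ _ _ ()) , s≤s z≤n , z≤n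

  via-two : ∀ {u m m' v} → u ≢ v → m ≢ m' → u ∼ m → m ∼ v → u ∼ m' → m' ∼ v → ShortDisjointChains u v
  via-two u≢v m≢m' r₁ r₂ r₁' r₂' =
    (via r₁ r₂ u≢v , via r₁' r₂' u≢v , (_ , here refl) , λ { _ (here refl) (here e) → m≢m' e }) , s≤s z≤n , s≤s z≤n

  shortChains-close : ∀ {g g' h h'} → (g , h) ≢ (g' , h') → AdjOrEq G g g' → AdjOrEq H h h' →
                      ShortDisjointChains (g , h) (g' , h')
  shortChains-close u≢v (inj₁ refl) (inj₁ refl) = ⊥-elim (u≢v refl)
  shortChains-close u≢v (inj₁ refl) (inj₂ h~h') with neighbour ntG CG _
  ... | g₁ , g~g₁ =
    edge-and-via (∼-introᴴ (inj₁ refl) h~h') (∼-introᴳ g~g₁ (inj₁ refl)) (∼-introᴳ (adjSym G g~g₁) (inj₂ h~h'))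
  shortChains-close u≢v (inj₂ g~g') (inj₁ refl) with neighbour ntH CH _
  ... | h₁ , h~h₁ =
    edge-and-via (∼-introᴳ g~g' (inj₁ refl)) (∼-introᴴ (inj₁ refl) h~h₁) (∼-introᴴ (inj₂ g~g') (adjSym H h~h₁))
  shortChains-close u≢v (inj₂ g~g') (inj₂ h~h') =
    edge-and-via (∼-introᴳ g~g' (inj₂ h~h')) (∼-introᴴ (inj₁ refl) h~h') (∼-introᴳ g~g' (inj₁ refl))

  -- The only obstruction to a second middle vertex is a unique centre in both factors.
  shortChains : ∀ u v → u ≢ v → ¬ (Diam G 2 × Diam H 2 × PropP G × PropP H) → ShortDisjointChains u v
  shortChains (g , h) (g' , h') u≢v ¬PP with diam≤2-dist diamG g g' | diam≤2-dist diamH h h'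
  ... | _ , j≤2 , Dg | _ , k≤2 , Dh with dist≤2-cases Dg j≤2 | dist≤2-cases Dh k≤2
  ... | inj₁ g≈g' | inj₁ h≈h' = shortChains-close u≢v g≈g' h≈h'
  ... | inj₂ (_ , w , g~w , w~g') | inj₁ h≈h' with another-middle ntH CH h≈h'
  ...   | k , h≢k , h≈k , k≈h' =
    via-two u≢v (λ e → h≢k (cong proj₂ e))
      (∼-introᴳ g~w (inj₁ refl)) (∼-introᴳ w~g' h≈h') (∼-introᴳ g~w h≈k) (∼-introᴳ w~g' k≈h')
  shortChains (g , h) (g' , h') u≢v ¬PP | _ | _ | inj₁ g≈g' | inj₂ (_ , x , h~x , x~h') with another-middle ntG CG g≈g'
  ...   | k , g≢k , g≈k , k≈g' =
    via-two u≢v (λ e → g≢k (cong proj₁ e))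
      (∼-introᴴ (inj₁ refl) h~x) (∼-introᴴ g≈g' x~h') (∼-introᴴ g≈k h~x) (∼-introᴴ k≈g' x~h')
  shortChains (g , h) (g' , h') u≢v ¬PP | _ | _ | inj₂ (Dg2 , w , g~w , w~g') | inj₂ (Dh2 , x , h~x , x~h')
    with another-centre-or-PropP (adj?-from-diam (proj₂ (proj₂ diamG))) Dg2 g~w w~g'
       | another-centre-or-PropP (adj?-from-diam (proj₂ (proj₂ diamH))) Dh2 h~x x~h'
  ... | inj₁ (w₂ , w₂≢w , g~w₂ , w₂~g') | _ =
    via-two u≢v (λ e → w₂≢w (sym (cong proj₁ e)))
      (∼-introᴳ g~w (inj₂ h~x)) (∼-introᴳ w~g' (inj₂ x~h'))
      (∼-introᴳ g~w₂ (inj₂ h~x)) (∼-introᴳ w₂~g' (inj₂ x~h'))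
  ... | inj₂ _ | inj₁ (x₂ , x₂≢x , h~x₂ , x₂~h') =
    via-two u≢v (λ e → x₂≢x (sym (cong proj₂ e)))
      (∼-introᴳ g~w (inj₂ h~x)) (∼-introᴳ w~g' (inj₂ x~h'))
      (∼-introᴳ g~w (inj₂ h~x₂)) (∼-introᴳ w~g' (inj₂ x₂~h'))
  ... | inj₂ PG | inj₂ PH = ⊥-elim (¬PP (diam≤2-dist2⇒diam2 diamG Dg2 , diam≤2-dist2⇒diam2 diamH Dh2 , PG , PH))

  monochrome-2-connected : ¬ (Diam G 2 × Diam H 2 × PropP G × PropP H) →
                           ProperVertexKConnected (G ⊠ H) 2 (monochrome {G ⊠ H})
  monochrome-2-connected ¬PP x y x≢y with shortChains (coords x) (coords y) (λ e → x≢y (coords-injective e)) ¬PP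
  ... | chains@(p , q , _) , p≤1 , q≤1 =
    pathPair (chain⇒productPath p) (chain⇒productPath q) , disjointChains⇒family chains ,
    λ { fzero → short p p≤1 ; (fsuc _) → short q q≤1 }
    where
    short : (c : Chain _∼_ (coords x) (coords y)) → length (proj₁ c) ≤ 1 →
            VertexProper (monochrome {G ⊠ H}) (chain⇒productPath {x} {y} c)
    short c c≤1 = short-path-proper (monochrome {G ⊠ H}) (chain⇒productPath c)
                    (subst (_≤ 2) (sym (len-chain⇒productPath {x} {y} c)) (s≤s c≤1))

module Results (G H : Graph) (ntG : Nontrivial G) (ntH : Nontrivial H) (CG : Connected G) (CH : Connected H) where
  open StrongProduct G H
  open ProductBounds G H ntG ntH

  open XorColouring G H (proj₁ (PathUnion.two-colouring G CG g₀)) (proj₂ (PathUnion.two-colouring G CG g₀))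
                        (proj₁ (PathUnion.two-colouring H CH h₀)) (proj₂ (PathUnion.two-colouring H CH h₀)) ntG ntH
    using (proper-2-connected) renaming (colouring to xorColouring)

  no-colouring₀-⊠ : ∀ {P : Coloring (G ⊠ H) 0 → Set} → ¬ Σ (Coloring (G ⊠ H) 0) P
  no-colouring₀-⊠ (c , _) = no-colouring₀ {G ⊠ H} (vertex (g₀ , h₀)) c

  ⊠-connected : Connected (G ⊠ H)
  ⊠-connected = proper-connected⇒connected proper-2-connected

  strong-monochrome : DiamLe2 G → DiamLe2 H → StrongProperVertexConnected (G ⊠ H) (monochrome {G ⊠ H})
  strong-monochrome diamG diamH =
    ProductColouring.strong-product G H (monochrome {G}) (monochrome {H})
      (diam≤2⇒strong-monochrome diamG) (diam≤2⇒strong-monochrome diamH)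

  -- Abstract, so that the type checker never runs the exhaustive colouring search on concrete graphs.
  abstract
    spvc-exists-⊠ : ∀ {dg dh} → Diam G dg → Diam H dh → ∃ (Spvc (G ⊠ H))
    spvc-exists-⊠ DG DH =
      StrongColouringSearch.spvc-exists
        (λ x y → ∼? (adj?-from-diam DG) (adj?-from-diam DH) (coords x) (coords y)) ⊠-connected

  pvc₁-complete : Complete G × Complete H → Pvc 1 (G ⊠ H) 0
  pvc₁-complete (completeG , completeH) = inj₁ ((refl , complete-⊠ completeG completeH) , refl)

  pvc₁-far : DiamGe3 G ⊎ DiamGe3 H → Pvc 1 (G ⊠ H) 2
  pvc₁-far far =
    inj₂ ((λ (_ , complete) → farPair⇒¬complete (farPair-⊠ far) complete) ,
          IsLeast-2 no-colouring₀-⊠ (farPair⇒¬proper-colouring₁ (farPair-⊠ far))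
                    (xorColouring , proper-2⇒proper-1-connected proper-2-connected))

  pvc₁-diam≤2 : ¬ (Complete G × Complete H) → DiamLe2 G → DiamLe2 H → Pvc 1 (G ⊠ H) 1
  pvc₁-diam≤2 ¬complete diamG diamH =
    inj₂ ((λ (_ , complete) → ¬complete (complete-⊠⁻ complete)) ,
          IsLeast-1 no-colouring₀-⊠ (monochrome {G ⊠ H} , strong⇒proper-1-connected (strong-monochrome diamG diamH)))

  pvc₂-diam≤2 : DiamLe2 G → DiamLe2 H → ¬ (Diam G 2 × Diam H 2 × PropP G × PropP H) → Pvc 2 (G ⊠ H) 1
  pvc₂-diam≤2 diamG diamH ¬PP =
    inj₂ ((λ { (() , _) }) ,
          IsLeast-1 no-colouring₀-⊠
            (monochrome {G ⊠ H} , ShortChains.monochrome-2-connected G H ntG ntH CG CH diamG diamH ¬PP))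

  pvc₂-obstructed : DiamGe3 G ⊎ DiamGe3 H ⊎ (Diam G 2 × Diam H 2 × PropP G × PropP H) → Pvc 2 (G ⊠ H) 2
  pvc₂-obstructed obstruction =
    inj₂ ((λ { (() , _) }) , IsLeast-2 no-colouring₀-⊠ (¬monochrome obstruction) (xorColouring , proper-2-connected))
    where
    ¬monochrome : DiamGe3 G ⊎ DiamGe3 H ⊎ (Diam G 2 × Diam H 2 × PropP G × PropP H) →
                  ¬ Σ (Coloring (G ⊠ H) 1) (ProperVertexKConnected (G ⊠ H) 2)
    ¬monochrome (inj₁ farG)                     = farPair⇒¬proper-colouring₁ (farPair-⊠ (inj₁ farG))
    ¬monochrome (inj₂ (inj₁ farH))              = farPair⇒¬proper-colouring₁ (farPair-⊠ (inj₂ farH))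
    ¬monochrome (inj₂ (inj₂ (_ , _ , PG , PH))) = propP⇒¬monochrome-2-connected PG PH

  spvc-complete : Complete G × Complete H → Spvc (G ⊠ H) 0
  spvc-complete (completeG , completeH) = inj₁ (complete-⊠ completeG completeH , refl)

  spvc-monochrome : DiamLe2 G → DiamLe2 H → (∃[ u ] ∃[ v ] Dist G u v 2) ⊎ (∃[ u ] ∃[ v ] Dist H u v 2) →
                    Spvc (G ⊠ H) 1
  spvc-monochrome diamG diamH dist2 =
    inj₂ (dist2⇒¬complete-⊠ dist2 , IsLeast-1 no-colouring₀-⊠ (monochrome {G ⊠ H} , strong-monochrome diamG diamH))

  spvc-diam2 : (Diam G 2 × DiamLe2 H) ⊎ (DiamLe2 G × Diam H 2) → Spvc (G ⊠ H) 1
  spvc-diam2 (inj₁ (diam2 , diamH)) = spvc-monochrome (2 , ≤-refl , diam2) diamH (inj₁ (proj₂ diam2))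
  spvc-diam2 (inj₂ (diamG , diam2)) = spvc-monochrome diamG (2 , ≤-refl , diam2) (inj₂ (proj₂ diam2))

  spvc-≤-spvcᴴ : DiamLe2 G → DiamGe3 H → ∃[ a ] (Spvc (G ⊠ H) a × (∀ b → Spvc H b → a ≤ b))
  spvc-≤-spvcᴴ diamG@(_ , _ , DG) diamH@(_ , _ , DH) = a , spvc , bound
    where
    a : ℕ
    a = proj₁ (spvc-exists-⊠ DG DH)
    spvc : Spvc (G ⊠ H) a
    spvc = proj₂ (spvc-exists-⊠ DG DH)
    bound : ∀ b → Spvc H b → a ≤ b
    bound b (inj₁ (completeH , _))       = ⊥-elim (diam≥3⇒¬complete diamH completeH)
    bound b (inj₂ (_ , (cH , spcH) , _)) =
      subst (a ≤_) (*-identityˡ b)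
        (Spvc-≤ spvc (farPair⇒¬complete (farPair-⊠ (inj₂ diamH)))
          (_ , ProductColouring.strong-product G H (monochrome {G}) cH (diam≤2⇒strong-monochrome diamG) spcH))

  spvc-≤-product : DiamGe3 G → DiamGe3 H → ∃[ a ] (Spvc (G ⊠ H) a × (∀ b c → Spvc G b → Spvc H c → a ≤ b * c))
  spvc-≤-product diamG@(_ , _ , DG) diamH@(_ , _ , DH) = a , spvc , bound
    where
    a : ℕ
    a = proj₁ (spvc-exists-⊠ DG DH)
    spvc : Spvc (G ⊠ H) a
    spvc = proj₂ (spvc-exists-⊠ DG DH)
    bound : ∀ b c → Spvc G b → Spvc H c → a ≤ b * c
    bound b c (inj₁ (completeG , _)) _ = ⊥-elim (diam≥3⇒¬complete diamG completeG)
    bound b c (inj₂ _) (inj₁ (completeH , _)) = ⊥-elim (diam≥3⇒¬complete diamH completeH)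
    bound b c (inj₂ (_ , (cG , spcG) , _)) (inj₂ (_ , (cH , spcH) , _)) =
      Spvc-≤ spvc (farPair⇒¬complete (farPair-⊠ (inj₂ diamH)))
        (_ , ProductColouring.strong-product G H cG cH spcG spcH)

-- Sharpness: K₂ ⊠ P₄

K₂ : Graph
K₂ = record { n = 2 ; Adj = _≢_ ; adjSym = λ i≢j e → i≢j (sym e) ; adjIrr = λ i≢i → i≢i refl }

P₄ : Graph
P₄ = record { n = 4 ; Adj = Consecutive ; adjSym = λ { (inj₁ e) → inj₂ e ; (inj₂ e) → inj₁ e } ; adjIrr = irr }
  module P₄ where
  Consecutive : Fin 4 → Fin 4 → Set
  Consecutive i j = toℕ j ≡ suc (toℕ i) ⊎ toℕ i ≡ suc (toℕ j)
  irr : ∀ {i} → ¬ Consecutive i i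
  irr (inj₁ e) = 1+n≢n (sym e)
  irr (inj₂ e) = 1+n≢n (sym e)

pattern v₀ = fzero
pattern v₁ = fsuc fzero
pattern v₂ = fsuc (fsuc fzero)
pattern v₃ = fsuc (fsuc (fsuc fzero))

consecutive? : ∀ i j → Dec (Adj P₄ i j)
consecutive? i j = (toℕ j ≟ℕ suc (toℕ i)) ⊎-dec (toℕ i ≟ℕ suc (toℕ j))

linePath : ∀ u v i → {True (Linked.linked? consecutive? (u ∷ i ++ v ∷ []))} →
           {True (UniqueDec.unique? _≟ᶠ_ (u ∷ i ++ v ∷ []))} → {True (length i ≤? 2)} →
           Σ (Path P₄ u v) λ p → len p ≤ 3
linePath u v i {lk} {un} {short} = mkPath i (toWitness lk) (toWitness un) , s≤s (toWitness short)

P₄-short-paths : ∀ u v → u ≢ v → Σ (Path P₄ u v) λ p → len p ≤ 3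
P₄-short-paths v₀ v₁ _ = linePath v₀ v₁ []
P₄-short-paths v₀ v₂ _ = linePath v₀ v₂ (v₁ ∷ [])
P₄-short-paths v₀ v₃ _ = linePath v₀ v₃ (v₁ ∷ v₂ ∷ [])
P₄-short-paths v₁ v₀ _ = linePath v₁ v₀ []
P₄-short-paths v₁ v₂ _ = linePath v₁ v₂ []
P₄-short-paths v₁ v₃ _ = linePath v₁ v₃ (v₂ ∷ [])
P₄-short-paths v₂ v₀ _ = linePath v₂ v₀ (v₁ ∷ [])
P₄-short-paths v₂ v₁ _ = linePath v₂ v₁ []
P₄-short-paths v₂ v₃ _ = linePath v₂ v₃ []
P₄-short-paths v₃ v₀ _ = linePath v₃ v₀ (v₂ ∷ v₁ ∷ [])
P₄-short-paths v₃ v₁ _ = linePath v₃ v₁ (v₂ ∷ [])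
P₄-short-paths v₃ v₂ _ = linePath v₃ v₂ []
P₄-short-paths v₀ v₀ u≢u = ⊥-elim (u≢u refl)
P₄-short-paths v₁ v₁ u≢u = ⊥-elim (u≢u refl)
P₄-short-paths v₂ v₂ u≢u = ⊥-elim (u≢u refl)
P₄-short-paths v₃ v₃ u≢u = ⊥-elim (u≢u refl)

P₄-connected : Connected P₄
P₄-connected u v u≢v = proj₁ (P₄-short-paths u v u≢v)

-- Each step changes the index by one, so no walk gains more than its length.
index-walk-≤ : ∀ a ys → Linked (Adj P₄) (a ∷ ys) → toℕ (lastOf a ys) ≤ toℕ a + length ys
index-walk-≤ a []       _          = ≤-reflexive (sym (+-identityʳ (toℕ a)))
index-walk-≤ a (b ∷ ys) (a~b ∷ lk) =
  ≤-trans (index-walk-≤ b ys lk) (≤-trans (+-monoˡ-≤ (length ys) (step a~b)) (≤-reflexive (sym (+-suc (toℕ a) (length ys)))))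
  where
  step : Adj P₄ a b → toℕ b ≤ suc (toℕ a)
  step (inj₁ e) = ≤-reflexive e
  step (inj₂ e) = ≤-trans (n≤1+n (toℕ b)) (≤-trans (≤-reflexive (sym e)) (n≤1+n (toℕ a)))

dist₀₃ : Dist P₄ v₀ v₃ 3
dist₀₃ = inj₂ (P₄-connected v₀ v₃ (λ ()) , refl , λ { (mkPath i lk _) →
  subst₂ _≤_ (cong toℕ (lastOf-∷ʳ v₀ i v₃)) (length-∷ʳ i v₃) (index-walk-≤ v₀ (i ++ v₃ ∷ []) lk) })

P₄-far : FarPair P₄
P₄-far = v₀ , v₃ , (λ ()) , dist-≤-len dist₀₃

P₄-dist : ∀ u v → ∃[ d ] Dist P₄ u v d
P₄-dist = dist-total consecutive? P₄-connected

diam-P₄ : DiamGe3 P₄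
diam-P₄ = 3 , ≤-refl , bounded , v₀ , v₃ , dist₀₃
  where
  bounded : ∀ u v → ∃[ j ] (j ≤ 3 × Dist P₄ u v j)
  bounded u v with P₄-dist u v | u ≟ᶠ v
  ... | d , D | yes refl = d , subst (_≤ 3) (sym (dist-self D)) z≤n , D
  ... | d , D | no  u≢v  = d , ≤-trans (dist-≤-len D (P₄-connected u v u≢v)) (proj₂ (P₄-short-paths u v u≢v)) , D

-- Neighbours on the path have indices of opposite parity, so every path is properly coloured.
parity-strong : StrongProperVertexConnected P₄ (λ i → parity (toℕ i))
parity-strong u v u≢v with dist⇒geodesic (proj₂ (P₄-dist u v)) u≢v
... | p , geo , _ = p , geo , Linked.map parity-≢ (chain-internal-linked (internal p , linked p , unique p))
  where
  parity-≢ : ∀ {i j} → Adj P₄ i j → parity (toℕ i) ≢ parity (toℕ j)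
  parity-≢ {i} (inj₁ e) c = parity-suc (toℕ i) (trans (sym (cong parity e)) (sym c))
  parity-≢ {j = j} (inj₂ e) c = parity-suc (toℕ j) (trans (sym (cong parity e)) c)

spvc-P₄ : Spvc P₄ 2
spvc-P₄ = inj₂ (farPair⇒¬complete P₄-far ,
                IsLeast-2 (λ (c , _) → no-colouring₀ {P₄} v₀ c) (farPair⇒¬strong-colouring₁ P₄-far) (_ , parity-strong))

diam-K₂ : DiamLe2 K₂
diam-K₂ = 1 , s≤s z≤n , bounded , v₀ , v₁ , inj₂ (edgePath {K₂} (λ ()) , refl , λ _ → s≤s z≤n)
  where
  bounded : ∀ u v → ∃[ j ] (j ≤ 1 × Dist K₂ u v j)
  bounded u v with u ≟ᶠ v
  ... | yes refl = 0 , z≤n , inj₁ (refl , refl)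
  ... | no  u≢v  = 1 , ≤-refl , inj₂ (edgePath {K₂} u≢v , refl , λ _ → s≤s z≤n)

nontrivial-K₂ : Nontrivial K₂
nontrivial-K₂ = s≤s (s≤s z≤n)

nontrivial-P₄ : Nontrivial P₄
nontrivial-P₄ = s≤s (s≤s z≤n)

sharpness : ∃[ G ] ∃[ H ] (Nontrivial G × Nontrivial H × Connected G × Connected H × DiamLe2 G × DiamGe3 H
                          × ∃[ a ] (Spvc (G ⊠ H) a × Spvc H a))
sharpness =
  K₂ , P₄ , nontrivial-K₂ , nontrivial-P₄ , (λ _ _ → edgePath {K₂}) , P₄-connected , diam-K₂ , diam-P₄ ,
  2 , subst (Spvc (K₂ ⊠ P₄)) a≡2 spvc , spvc-P₄
  where
  open Results K₂ P₄ nontrivial-K₂ nontrivial-P₄ (λ _ _ → edgePath {K₂}) P₄-connected using (spvc-≤-spvcᴴ)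
  a : ℕ
  a = proj₁ (spvc-≤-spvcᴴ diam-K₂ diam-P₄)
  spvc : Spvc (K₂ ⊠ P₄) a
  spvc = proj₁ (proj₂ (spvc-≤-spvcᴴ diam-K₂ diam-P₄))
  a≡2 : a ≡ 2
  a≡2 = ≤-antisym (proj₂ (proj₂ (spvc-≤-spvcᴴ diam-K₂ diam-P₄)) 2 spvc-P₄)
          (farPair⇒2≤spvc (ProductBounds.farPair-⊠ K₂ P₄ nontrivial-K₂ nontrivial-P₄ (inj₂ diam-P₄)) spvc)

theorem5p2 :
    (∀ (G H : Graph) → Nontrivial G → Nontrivial H → Connected G → Connected H →
      -- (1)
      ((Complete G × Complete H → Pvc 1 (G ⊠ H) 0)
       × (DiamGe3 G ⊎ DiamGe3 H → Pvc 1 (G ⊠ H) 2)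
       × (¬ (Complete G × Complete H) → DiamLe2 G → DiamLe2 H → Pvc 1 (G ⊠ H) 1))
      -- (2)
      × ((DiamLe2 G → DiamLe2 H →
            ¬ (Diam G 2 × Diam H 2 × PropP G × PropP H) → Pvc 2 (G ⊠ H) 1)
         × (DiamGe3 G ⊎ DiamGe3 H ⊎ (Diam G 2 × Diam H 2 × PropP G × PropP H) →
            Pvc 2 (G ⊠ H) 2))
      -- (3)
      × ((Complete G × Complete H → Spvc (G ⊠ H) 0)
         × ((Diam G 2 × DiamLe2 H) ⊎ (DiamLe2 G × Diam H 2) → Spvc (G ⊠ H) 1)
         × (DiamLe2 G → DiamGe3 H →
              ∃[ a ] (Spvc (G ⊠ H) a × (∀ b → Spvc H b → a ≤ b)))
         × (DiamGe3 G → DiamGe3 H →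
              ∃[ a ] (Spvc (G ⊠ H) a × (∀ b c → Spvc G b → Spvc H c → a ≤ b * c)))))
    -- (3) sharpness of the bound spvc(G ⊠ H) ≤ spvc(H)
    × (∃[ G ] ∃[ H ] (Nontrivial G × Nontrivial H × Connected G × Connected H
         × DiamLe2 G × DiamGe3 H
         × ∃[ a ] (Spvc (G ⊠ H) a × Spvc H a)))
theorem5p2 =
  (λ G H ntG ntH CG CH → let open Results G H ntG ntH CG CH in
    (pvc₁-complete , pvc₁-far , pvc₁-diam≤2) ,
    (pvc₂-diam≤2 , pvc₂-obstructed) ,
    (spvc-complete , spvc-diam2 , spvc-≤-spvcᴴ , spvc-≤-product)) ,
  sharpness
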